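{- Let $q$ be a prime power. Let $m_1,n_1,m_3,n_3$ be positive integers, $m=m_1+m_3$, $n=n_1+n_3$; let $\mathcal F_1\subseteq[m_1]\times[n_1]$ be an $m_1\times n_1$ Ferrers diagram, $\mathcal F_2=\{(0,0)\}$ the $1\times1$ Ferrers diagram, $\mathcal F_3\subseteq[m_3]\times[n_3]$ an $m_3\times n_3$ Ferrers diagram and $\mathcal F_4=[m_1]\times[n_3]$ the full $m_1\times n_3$ diagram, and let $$\mathcal F=\mathcal F_1\cup\{(m_1,n_1-1)\}\cup\{(i,n_1+j):(i,j)\in\mathcal F_4\}\cup\{(m_1+i,n_1+j):(i,j)\in\mathcal F_3\}$$ (an $m\times n$ Ferrers diagram). Sort the multiset $\{1\}\cup\{\rho_i(\mathcal F_1):i\in[m_1]\}\cup\{\gamma_j(\mathcal F_3):j\in[n_3]\}$ in nondecreasing order as $\alpha_0\le\alpha_1\le\cdots\le\alpha_{m_1+n_3}$, where $\rho_i(\mathcal F_1)$ is the number of dots in row $i$ of $\mathcal F_1$ and $\gamma_j(\mathcal F_3)$ the number of dots in column $j$ of $\mathcal F_3$. Suppose $\mathcal F_{123}$ is a Ferrers diagram that is a proper combination of $\mathcal F_1,\mathcal F_2,\mathcal F_3$ such that column $l$ of $\mathcal F_{123}$ has exactly $\alpha_l$ dots for each $l\in[m_1+n_3+1]$, that there exists an $[\mathcal F_{123},k_1,\delta_1]_q$ code, and that there exists an $[\mathcal F_4,k_4,\delta_4]_q$ code. Then there exists an $[\mathcal F,k_1+k_4,\min\{\delta_1,\delta_4\}]_q$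 code.
   Context: $[a]$ denotes $\{0,1,\dots,a-1\}$. An $m\times n$ Ferrers diagram is a set $\mathcal F\subseteq[m]\times[n]$ of cells ("dots") such that: if $(i,j)\in\mathcal F$, $i\ge1$ then $(i-1,j)\in\mathcal F$; if $(i,j)\in\mathcal F$, $j\le n-2$ then $(i,j+1)\in\mathcal F$; row $0$ has $n$ dots and column $n-1$ has $m$ dots. An $[\mathcal F,k,\delta]_q$ code is a $k$-dimensional $\mathbb F_q$-linear subspace of $\mathbb F_q^{m\times n}$ all of whose matrices have zero entries outside $\mathcal F$ and whose nonzero matrices all have rank at least $\delta$. A Ferrers diagram $\mathcal G$ is a proper combination of Ferrers diagrams $\mathcal F_1,\dots,\mathcal F_s$ if there are injections $\phi_l:\mathcal F_l\to\mathcal G$ with pairwise disjoint images, $\sum_l|\mathcal F_l|=|\mathcal G|$, and such that for each $l$ and any two distinct cells of $\mathcal F_l$ lying in the same row or in the same column, their images under $\phi_l$ lie in the same row or in the same column of $\mathcal G$. -}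

module Defs where

open import Level using (Level; _⊔_) renaming (suc to lsuc)
open import Algebra.Bundles using (CommutativeRing)
open import Data.Nat using (ℕ; zero; suc; _+_; _∸_; _^_; _≤_; _<_)
open import Data.Fin using (Fin; toℕ; splitAt)
import Data.Fin as F
open import Data.Bool using (Bool; true; false; if_then_else_; _∧_)
open import Data.Product using (Σ; _×_; _,_; proj₁; proj₂)
open import Data.Sum using (_⊎_; inj₁; inj₂)
open import Data.List using (List; _∷_; _++_; tabulate)
open import Data.Nat.Primality using (Prime)
open import Relation.Nullary using (¬_)
open import Relation.Binary.PropositionalEquality using (_≡_; _≢_; setoid)
open import Function.Bundles using (Inverse)
open import Function using (_∘_)

PrimePower : ℕ → Set
PrimePower q = Σ ℕ λ p → Σ ℕ λ e → Prime p × q ≡ p ^ suc e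

record Field (c ℓ : Level) : Set (lsuc (c ⊔ ℓ)) where
  field
    commutativeRing : CommutativeRing c ℓ
  open CommutativeRing commutativeRing using (Carrier; _≈_; _≉_; _*_; 0#; 1#)
  field
    0≉1     : 0# ≉ 1#
    inverse : ∀ x → x ≉ 0# → Σ Carrier λ y → x * y ≈ 1#
  open CommutativeRing commutativeRing public

HasCardinality : ∀ {c ℓ} → Field c ℓ → ℕ → Set (c ⊔ ℓ)
HasCardinality K q = Inverse (setoid (Fin q)) (Field.setoid K)

count : ∀ {n} → (Fin n → Bool) → ℕ
count {zero}  f = 0
count {suc n} f = (if f F.zero then 1 else 0) + count (f ∘ F.suc)

sumFin : ∀ {n} → (Fin n → ℕ) → ℕ
sumFin {zero}  f = 0
sumFin {suc n} f = f F.zero + sumFin (f ∘ F.suc)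

Diagram : ℕ → ℕ → Set
Diagram m n = Fin m → Fin n → Bool

Dot : ∀ {m n} → Diagram m n → Fin m → Fin n → Set
Dot D i j = D i j ≡ true

rowCount : ∀ {m n} → Diagram m n → Fin m → ℕ
rowCount D i = count (D i)

colCount : ∀ {m n} → Diagram m n → Fin n → ℕ
colCount D j = count (λ i → D i j)

size : ∀ {m n} → Diagram m n → ℕ
size D = sumFin (rowCount D)

record IsFerrers {m n : ℕ} (D : Diagram m n) : Set where
  field
    up    : ∀ (i i' : Fin m) (j : Fin n) → suc (toℕ i') ≡ toℕ i → Dot D i j → Dot D i' j
    right : ∀ (i : Fin m) (j j' : Fin n) → toℕ j' ≡ suc (toℕ j) → Dot D i j → Dot D i j'
    row0  : Σ (Fin m) λ i → toℕ i ≡ 0 × rowCount D i ≡ n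
    colLast : Σ (Fin n) λ j → suc (toℕ j) ≡ n × colCount D j ≡ m

full : ∀ m n → Diagram m n
full m n _ _ = true

Cell : ℕ → ℕ → Set
Cell M N = Fin M × Fin N

record IsProperCombination {s M N : ℕ} {a b : Fin s → ℕ}
         (Fs : (l : Fin s) → Diagram (a l) (b l)) (G : Diagram M N) : Set where
  field
    φ        : (l : Fin s) → Fin (a l) → Fin (b l) → Cell M N
    into     : ∀ l i j → Dot (Fs l) i j → Dot G (proj₁ (φ l i j)) (proj₂ (φ l i j))
    injective : ∀ l i j i' j' → Dot (Fs l) i j → Dot (Fs l) i' j' →
                φ l i j ≡ φ l i' j' → (i ≡ i' × j ≡ j')
    disjoint : ∀ l l' → l ≢ l' → ∀ i j i' j' → Dot (Fs l) i j → Dot (Fs l') i' j' →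
               φ l i j ≢ φ l' i' j'
    sizes    : sumFin (λ l → size (Fs l)) ≡ size G
    lines    : ∀ l i j i' j' → Dot (Fs l) i j → Dot (Fs l) i' j' →
               ¬ (i ≡ i' × j ≡ j') → (i ≡ i' ⊎ j ≡ j') →
               (proj₁ (φ l i j) ≡ proj₁ (φ l i' j') ⊎ proj₂ (φ l i j) ≡ proj₂ (φ l i' j'))

dims3 : ℕ → ℕ → ℕ → Fin 3 → ℕ
dims3 x y z F.zero = x
dims3 x y z (F.suc F.zero) = y
dims3 x y z (F.suc (F.suc F.zero)) = z

family3 : ∀ {a₁ b₁ a₂ b₂ a₃ b₃} → Diagram a₁ b₁ → Diagram a₂ b₂ → Diagram a₃ b₃ →
          (l : Fin 3) → Diagram (dims3 a₁ a₂ a₃ l) (dims3 b₁ b₂ b₃ l)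
family3 D₁ D₂ D₃ F.zero = D₁
family3 D₁ D₂ D₃ (F.suc F.zero) = D₂
family3 D₁ D₂ D₃ (F.suc (F.suc F.zero)) = D₃

isZero : ℕ → Bool
isZero zero = true
isZero (suc _) = false

eqℕ : ℕ → ℕ → Bool
eqℕ zero zero = true
eqℕ zero (suc _) = false
eqℕ (suc _) zero = false
eqℕ (suc a) (suc b) = eqℕ a b

compose : ∀ {m₁ n₁ m₃ n₃} → Diagram m₁ n₁ → Diagram m₁ n₃ → Diagram m₃ n₃ →
          Diagram (m₁ + m₃) (n₁ + n₃)
compose {m₁} {n₁} F₁ F₄ F₃ i j with splitAt m₁ i | splitAt n₁ j
... | inj₁ i₁ | inj₁ j₁ = F₁ i₁ j₁
... | inj₁ i₁ | inj₂ j₃ = F₄ i₁ j₃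
... | inj₂ i₃ | inj₁ j₁ = isZero (toℕ i₃) ∧ eqℕ (suc (toℕ j₁)) n₁
... | inj₂ i₃ | inj₂ j₃ = F₃ i₃ j₃

module _ {c ℓ} (K : Field c ℓ) where
  open Field K hiding (_+_)
  open Field K using () renaming (_+_ to _⊕_)

  Mat : ℕ → ℕ → Set c
  Mat m n = Fin m → Fin n → Carrier

  ∑ : ∀ {k} → (Fin k → Carrier) → Carrier
  ∑ {zero}  f = 0#
  ∑ {suc k} f = f F.zero ⊕ ∑ (f ∘ F.suc)

  lincomb : ∀ {k m n} → (Fin k → Carrier) → (Fin k → Mat m n) → Mat m n
  lincomb cs B i j = ∑ (λ t → cs t * B t i j)

  IsZeroMat : ∀ {m n} → Mat m n → Set ℓ
  IsZeroMat A = ∀ i j → A i j ≈ 0#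

  RankAtLeast : ∀ {m n} → Mat m n → ℕ → Set (c ⊔ ℓ)
  RankAtLeast {m} {n} A δ =
    Σ (Fin δ → Fin m) λ r →
      (∀ t t' → r t ≡ r t' → t ≡ t') ×
      (∀ (cs : Fin δ → Carrier) → (∀ j → ∑ (λ t → cs t * A (r t) j) ≈ 0#) → ∀ t → cs t ≈ 0#)

  -- An [D, k, δ]_K code: a k-dimensional subspace of K^{m×n}, given by a basis
  -- B_0,…,B_{k-1} (linearly independent matrices), all of whose elements vanish
  -- outside D and whose nonzero elements have rank ≥ δ.
  Code : ∀ {m n} → Diagram m n → ℕ → ℕ → Set (c ⊔ ℓ)
  Code {m} {n} D k δ =
    Σ (Fin k → Mat m n) λ B →
      (∀ t i j → D i j ≡ false → B t i j ≈ 0#) ×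
      (∀ (cs : Fin k → Carrier) → IsZeroMat (lincomb cs B) → ∀ t → cs t ≈ 0#) ×
      (∀ (cs : Fin k → Carrier) → ¬ IsZeroMat (lincomb cs B) → RankAtLeast (lincomb cs B) δ)

module Submission where

-- Let X be a codeword of the code on F₁₂₃. By the size count, the columns of F₁₂₃ carrying dots are
-- among its first 1 + m₁ + n₃ ones, and by the permutation hypothesis these can be matched with the
-- lines of F (the corner cell (m₁, n₁ − 1), the rows of F₁ and the columns of F₃), each column having
-- as many dots as its line. Writing every such column of X into its line (reversed along a row of F₁)
-- gives an injective linear map into matrices on F, and codewords of the full code on F₄ fill the
-- top-right block, which the map leaves empty; hence the dimension k₁ + k₄.
--
-- The map loses no rank: δ independent rows of X give a nonsingular δ × δ minor, hence δ independent
-- columns of X, i.e. δ lines with independent contents. Rows of F₁ are rows of F; for the remaining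
-- lines a second minor picks rows of the bottom block. The two kinds of chosen rows overlap only in
-- column n₁ − 1, where the bottom rows carry the corner's content; when the corner is among the chosen
-- lines, that content is a nonzero multiple of the first unit vector and absorbs the overlap. If the
-- F₄-part of a codeword is nonzero, its rows alone give rank δ₄.

open import Defs
open import Level using (Level; _⊔_)
import Algebra.Properties.CommutativeMonoid.Sum as CommutativeMonoidSum
import Algebra.Properties.CommutativeSemigroup as CommutativeSemigroupProperties
import Algebra.Properties.Ring as RingProperties
import Algebra.Properties.Semiring.Sum as SemiringSum
open import Data.Bool using (Bool; true; false; if_then_else_)
open import Data.Empty using (⊥-elim)
open import Data.Fin using (Fin; toℕ; fromℕ; fromℕ<; inject₁; inject≤; cast; opposite; splitAt; _↑ˡ_; _↑ʳ_)
  renaming (zero to fzero; suc to fsuc)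
import Data.Fin as Fin
open import Data.Fin.Induction using (<-weakInduction-startingFrom)
open import Data.Fin.Permutation using (Permutation; Permutation′; _⟨$⟩ʳ_; _⟨$⟩ˡ_; _∘ₚ_; cast-id; inverseˡ; inverseʳ)
open import Data.Fin.Properties
  using (toℕ-injective; toℕ-fromℕ; toℕ-fromℕ<; fromℕ<-toℕ; toℕ-inject₁; toℕ-inject≤; toℕ<n; cast-involutive;
         opposite-prop; opposite-involutive; splitAt-↑ˡ; splitAt-↑ʳ; splitAt⁻¹-↑ˡ; splitAt⁻¹-↑ʳ; ¬∀⟶∃¬; all?; any?)
open import Data.List using (_∷_; _++_; length; tabulate; lookup)
open import Data.List.Properties using (length-tabulate; lookup-tabulate; tabulate-cong)
open import Data.List.Relation.Binary.Permutation.Homogeneous using (onIndices)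
open import Data.List.Relation.Binary.Permutation.Propositional using (_↭_; ↭⇒↭ₛ)
open import Data.List.Relation.Binary.Permutation.Setoid.Properties using (onIndices-lookup)
open import Data.Nat using (ℕ; zero; suc; _+_; _∸_; _≤_; _<_; _⊓_; z≤n; s≤s; s≤s⁻¹; _<?_)
import Data.Nat.Properties as ℕ
open import Data.Nat.ListAction using (sum)
open import Data.Nat.ListAction.Properties using (sum-↭; sum-++)
open import Data.Nat.Tactic.RingSolver using (solve-∀)
open import Data.Product using (Σ; ∃; _×_; _,_; proj₁; proj₂; map; uncurry)
open import Data.Sum using (_⊎_; inj₁; inj₂)
open import Data.Vec.Functional as Vector using (Vector)
open import Data.Vec.Functional.Properties using (lookup-++ˡ; lookup-++ʳ)
open import Function using (_∘_)
open import Function.Bundles using (Inverse)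
open import Relation.Binary using (Decidable)
open import Relation.Binary.PropositionalEquality as ≡ using (_≡_; _≢_; module ≡-Reasoning)
open import Relation.Nullary using (¬_; Dec; yes; no)
open import Relation.Nullary.Decidable using (map′)

UpClosed DownClosed : ∀ {n} → (Fin n → Bool) → Set
UpClosed   f = ∀ {i j} → toℕ i ≤ toℕ j → f i ≡ true → f j ≡ true
DownClosed f = ∀ {i j} → toℕ i ≤ toℕ j → f j ≡ true → f i ≡ true

contradictory-bool : ∀ {b} → b ≡ true → b ≡ false → ∀ {a} {A : Set a} → A
contradictory-bool ≡.refl ()

count≤n : ∀ {n} (f : Fin n → Bool) → count f ≤ n
count≤n {zero}  f = z≤n
count≤n {suc n} f with f fzero
... | true  = s≤s (count≤n (f ∘ fsuc))
... | false = ℕ.m≤n⇒m≤1+n (count≤n (f ∘ fsuc))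

count-allFalse : ∀ {n} (f : Fin n → Bool) → (∀ i → f i ≡ false) → count f ≡ 0
count-allFalse {zero}  f _        = ≡.refl
count-allFalse {suc n} f allFalse rewrite allFalse fzero = count-allFalse (f ∘ fsuc) (allFalse ∘ fsuc)

true⇒<count : ∀ {n} {f : Fin n → Bool} → DownClosed f → ∀ {i} → f i ≡ true → toℕ i < count f
true⇒<count {suc n} {f} closed {i} fi with f fzero in f₀ | i
... | false | _      = contradictory-bool (closed z≤n fi) f₀
... | true  | fzero  = s≤s z≤n
... | true  | fsuc i = s≤s (true⇒<count (closed ∘ s≤s) fi)

false⇒count≤ : ∀ {n} {f : Fin n → Bool} → DownClosed f → ∀ {i} → f i ≡ false → count f ≤ toℕ i
false⇒count≤ {suc n} {f} closed {i} fi with f fzero in f₀ | i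
... | false | _      = ≡.subst (_≤ _) (≡.sym (count-allFalse (f ∘ fsuc) tail-false)) z≤n
  where
  tail-false : ∀ j → f (fsuc j) ≡ false
  tail-false j with f (fsuc j) in fj
  ... | true  = contradictory-bool (closed z≤n fj) f₀
  ... | false = ≡.refl
... | true  | fzero  = contradictory-bool f₀ fi
... | true  | fsuc i = s≤s (false⇒count≤ (closed ∘ s≤s) fi)

false⇒count≤∸ : ∀ {n} {f : Fin n → Bool} → UpClosed f → ∀ {i} → f i ≡ false → count f ≤ n ∸ suc (toℕ i)
false⇒count≤∸ {suc n} {f} closed {i} fi with f fzero in f₀ | i
... | true  | _      = contradictory-bool (closed z≤n f₀) fi
... | false | fzero  = count≤n (f ∘ fsuc)
... | false | fsuc i = false⇒count≤∸ (closed ∘ s≤s) fi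

stepwise-upward : ∀ {k} (P : Fin k → Set) → (∀ i j → toℕ j ≡ suc (toℕ i) → P i → P j) →
                  ∀ {i j} → toℕ i ≤ toℕ j → P i → P j
stepwise-upward {suc k} P step i≤j Pi =
  <-weakInduction-startingFrom P Pi (λ j → step (inject₁ j) (fsuc j) (≡.cong suc (≡.sym (toℕ-inject₁ j)))) i≤j

module Ferrers {m n} {D : Diagram m n} (ferrers : IsFerrers D) where

  open IsFerrers ferrers

  row-upClosed : ∀ i → UpClosed (D i)
  row-upClosed i = stepwise-upward (λ j → D i j ≡ true) (right i)

  column-downClosed : ∀ l → DownClosed (λ r → D r l)
  column-downClosed l {i} {j} i≤j Dj with D i l in Di
  ... | true  = ≡.refl
  ... | false = contradictory-bool Dj (stepwise-upward (λ r → D r l ≡ false) noDot-below i≤j Di)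
    where
    noDot-below : ∀ r r′ → toℕ r′ ≡ suc (toℕ r) → D r l ≡ false → D r′ l ≡ false
    noDot-below r r′ r′≡1+r Dr with D r′ l in Dr′
    ... | true  = contradictory-bool (up r′ r l (≡.sym r′≡1+r) Dr′) Dr
    ... | false = ≡.refl

  dot⇒<colCount : ∀ {r l} → Dot D r l → toℕ r < colCount D l
  dot⇒<colCount {l = l} = true⇒<count (column-downClosed l)

  noDot⇒colCount≤ : ∀ {r l} → D r l ≡ false → colCount D l ≤ toℕ r
  noDot⇒colCount≤ {l = l} = false⇒count≤ (column-downClosed l)

  noDot⇒rowCount≤ : ∀ {i c} → D i c ≡ false → rowCount D i ≤ n ∸ suc (toℕ c)
  noDot⇒rowCount≤ {i} = false⇒count≤∸ (row-upClosed i)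

module ℕΣ = CommutativeMonoidSum ℕ.+-0-commutativeMonoid

sumFin≡sum : ∀ {n} (f : Fin n → ℕ) → sumFin f ≡ ℕΣ.sum f
sumFin≡sum {zero}  f = ≡.refl
sumFin≡sum {suc n} f = ≡.cong (f fzero +_) (sumFin≡sum (f ∘ fsuc))

sumFin-cong : ∀ {n} {f g : Fin n → ℕ} → (∀ i → f i ≡ g i) → sumFin f ≡ sumFin g
sumFin-cong {f = f} {g} f≗g = ≡.trans (sumFin≡sum f) (≡.trans (ℕΣ.sum-cong-≗ f≗g) (≡.sym (sumFin≡sum g)))

sum-tabulate : ∀ {n} (f : Fin n → ℕ) → sum (tabulate f) ≡ sumFin f
sum-tabulate {zero}  f = ≡.refl
sum-tabulate {suc n} f = ≡.cong (f fzero +_) (sum-tabulate (f ∘ fsuc))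

count≡sum : ∀ {n} (f : Fin n → Bool) → count f ≡ ℕΣ.sum (λ i → if f i then 1 else 0)
count≡sum {zero}  f = ≡.refl
count≡sum {suc n} f = ≡.cong ((if f fzero then 1 else 0) +_) (count≡sum (f ∘ fsuc))

size≡sumFin-colCount : ∀ {m n} (D : Diagram m n) → size D ≡ sumFin (colCount D)
size≡sumFin-colCount D = begin
  sumFin (rowCount D)                                  ≡⟨ sumFin≡sum (rowCount D) ⟩
  ℕΣ.sum (rowCount D)                                  ≡⟨ ℕΣ.sum-cong-≗ (λ i → count≡sum (D i)) ⟩
  ℕΣ.sum (λ i → ℕΣ.sum (λ j → if D i j then 1 else 0)) ≡⟨ ℕΣ.∑-comm (λ i j → if D i j then 1 else 0) ⟩
  ℕΣ.sum (λ j → ℕΣ.sum (λ i → if D i j then 1 else 0)) ≡⟨ ℕΣ.sum-cong-≗ (λ j → count≡sum (λ i → D i j)) ⟨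
  ℕΣ.sum (colCount D)                                  ≡⟨ sumFin≡sum (colCount D) ⟨
  sumFin (colCount D)                                  ∎
  where open ≡-Reasoning

term≤sumFin : ∀ {n} (h : Fin n → ℕ) l → h l ≤ sumFin h
term≤sumFin h fzero    = ℕ.m≤m+n _ _
term≤sumFin h (fsuc l) = ℕ.≤-trans (term≤sumFin (h ∘ fsuc) l) (ℕ.m≤n+m _ (h fzero))

sumFin-inject≤+term≤sumFin : ∀ L {N} (h : Fin N → ℕ) .(L≤N : L ≤ N) l → L ≤ toℕ l →
                             sumFin (λ l′ → h (inject≤ l′ L≤N)) + h l ≤ sumFin h
sumFin-inject≤+term≤sumFin zero            h _   l        _         = term≤sumFin h l
sumFin-inject≤+term≤sumFin (suc L) {suc N} h L≤N (fsuc l) (s≤s L≤l)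
  rewrite ℕ.+-assoc (h fzero) (sumFin (λ l′ → h (fsuc (inject≤ l′ (s≤s⁻¹ L≤N))))) (h (fsuc l)) =
  ℕ.+-monoʳ-≤ (h fzero) (sumFin-inject≤+term≤sumFin L (h ∘ fsuc) (s≤s⁻¹ L≤N) l L≤l)

sumFin-prefix⇒later≡0 : ∀ L {N} (h : Fin N → ℕ) .(L≤N : L ≤ N) → sumFin (λ l → h (inject≤ l L≤N)) ≡ sumFin h →
                        ∀ l → L ≤ toℕ l → h l ≡ 0
sumFin-prefix⇒later≡0 L h L≤N prefix≡total l L≤l = ℕ.n≤0⇒n≡0 (ℕ.+-cancelˡ-≤ prefix (h l) 0 (begin
  prefix + h l ≤⟨ sumFin-inject≤+term≤sumFin L h L≤N l L≤l ⟩
  sumFin h     ≡⟨ prefix≡total ⟨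
  prefix       ≡⟨ ℕ.+-identityʳ prefix ⟨
  prefix + 0   ∎))
  where
  open ℕ.≤-Reasoning
  prefix : ℕ
  prefix = sumFin (λ l → h (inject≤ l L≤N))

indices<⇒≤ : ∀ {L N} → (∀ (l : Fin L) → toℕ l < N) → L ≤ N
indices<⇒≤ {zero}  _        = z≤n
indices<⇒≤ {suc L} indices< = ≡.subst (_< _) (toℕ-fromℕ L) (indices< (fromℕ L))

∀-splitAt : ∀ m {n p} {P : Fin (m + n) → Set p} → (∀ i → P (i ↑ˡ n)) → (∀ j → P (m ↑ʳ j)) → ∀ k → P k
∀-splitAt m {P = P} P-left P-right k with splitAt m k in eq
... | inj₁ i = ≡.subst P (splitAt⁻¹-↑ˡ eq) (P-left i)
... | inj₂ j = ≡.subst P (splitAt⁻¹-↑ʳ eq) (P-right j)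

tabulate-++ : ∀ {a} {A : Set a} {m n} (f : Vector A m) (g : Vector A n) →
              tabulate (f Vector.++ g) ≡ tabulate f ++ tabulate g
tabulate-++ {m = zero}  f g = ≡.refl
tabulate-++ {m = suc m} f g = ≡.cong (f fzero ∷_) (≡.trans (tabulate-cong tail-++) (tabulate-++ (f ∘ fsuc) g))
  where
  tail-++ : ∀ i → (f Vector.++ g) (fsuc i) ≡ ((f ∘ fsuc) Vector.++ g) i
  tail-++ i with splitAt m i
  ... | inj₁ _ = ≡.refl
  ... | inj₂ _ = ≡.refl

↭-tabulate⇒permutation : ∀ {a} {A : Set a} {n} {f g : Vector A n} → tabulate f ↭ tabulate g →
                         Σ (Permutation′ n) λ σ → ∀ i → f i ≡ g (σ ⟨$⟩ʳ i)
↭-tabulate⇒permutation {A = A} {n} {f} {g} f↭g = σ , f≡g∘σ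
  where
  π : Permutation (length (tabulate f)) (length (tabulate g))
  π = onIndices (↭⇒↭ₛ f↭g)
  σ : Permutation′ n
  σ = cast-id (≡.sym (length-tabulate f)) ∘ₚ π ∘ₚ cast-id (length-tabulate g)
  f≡g∘σ : ∀ i → f i ≡ g (σ ⟨$⟩ʳ i)
  f≡g∘σ i = begin
    f i                                            ≡⟨ lookup-tabulate f i ⟨
    lookup (tabulate f) i′                         ≡⟨ onIndices-lookup (≡.setoid A) (↭⇒↭ₛ f↭g) i′ ⟩
    lookup (tabulate g) (π ⟨$⟩ʳ i′)                ≡⟨ ≡.cong (lookup (tabulate g)) (cast-involutive (≡.sym ℓg) ℓg _) ⟨
    lookup (tabulate g) (cast (≡.sym ℓg) (σ ⟨$⟩ʳ i)) ≡⟨ lookup-tabulate g (σ ⟨$⟩ʳ i) ⟩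
    g (σ ⟨$⟩ʳ i)                                   ∎
    where
    open ≡-Reasoning
    i′ : Fin (length (tabulate f))
    i′ = cast (≡.sym (length-tabulate f)) i
    ℓg : length (tabulate g) ≡ n
    ℓg = length-tabulate g

-- Linear algebra over a field

module LinearAlgebra {c ℓ} (K : Field c ℓ) where

  open Field K renaming (_+_ to _⊕_)
  open RingProperties ring using (-‿involutive; +-inverseʳ-unique; -‿distribˡ-*; -‿distribʳ-*; -1*x≈-x; x[y-z]≈xy-xz)
  open CommutativeSemigroupProperties *-commutativeSemigroup using (x∙yz≈y∙xz)
  open CommutativeSemigroupProperties +-commutativeSemigroup using () renaming (x∙yz≈y∙xz to x⊕[y⊕z]≈y⊕[x⊕z])
  module KΣ = SemiringSum semiring
  open import Relation.Binary.Reasoning.Setoid setoid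

  ⊕≈0-cancelˡ : ∀ {x y} → x ≈ 0# → x ⊕ y ≈ 0# → y ≈ 0#
  ⊕≈0-cancelˡ {x} {y} x≈0 x⊕y≈0 = trans (sym (+-identityˡ y)) (trans (+-congʳ (sym x≈0)) x⊕y≈0)

  ⊕≈0-cancelʳ : ∀ {x y} → y ≈ 0# → x ⊕ y ≈ 0# → x ≈ 0#
  ⊕≈0-cancelʳ y≈0 x⊕y≈0 = ⊕≈0-cancelˡ y≈0 (trans (+-comm _ _) x⊕y≈0)

  ∑≡sum : ∀ {k} (f : Fin k → Carrier) → ∑ K f ≡ KΣ.sum f
  ∑≡sum {zero}  f = ≡.refl
  ∑≡sum {suc k} f = ≡.cong (f fzero ⊕_) (∑≡sum (f ∘ fsuc))

  ∑-cong : ∀ {k} {f g : Fin k → Carrier} → (∀ t → f t ≈ g t) → ∑ K f ≈ ∑ K g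
  ∑-cong {f = f} {g} f≈g rewrite ∑≡sum f | ∑≡sum g = KΣ.sum-cong-≋ f≈g

  ∑-zero : ∀ {k} {f : Fin k → Carrier} → (∀ t → f t ≈ 0#) → ∑ K f ≈ 0#
  ∑-zero {k} f≈0 = trans (∑-cong f≈0) (trans (reflexive (∑≡sum {k} (λ _ → 0#))) (KΣ.sum-replicate-zero k))

  ∑-distrib-⊕ : ∀ {k} (f g : Fin k → Carrier) → ∑ K (λ t → f t ⊕ g t) ≈ ∑ K f ⊕ ∑ K g
  ∑-distrib-⊕ f g rewrite ∑≡sum (λ t → f t ⊕ g t) | ∑≡sum f | ∑≡sum g = KΣ.∑-distrib-+ f g

  *-distribˡ-∑ : ∀ {k} x (f : Fin k → Carrier) → x * ∑ K f ≈ ∑ K (λ t → x * f t)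
  *-distribˡ-∑ x f rewrite ∑≡sum f | ∑≡sum (λ t → x * f t) = KΣ.*-distribˡ-sum x f

  ∑-neg : ∀ {k} (f : Fin k → Carrier) → ∑ K (λ t → - f t) ≈ - ∑ K f
  ∑-neg f = begin
    ∑ K (λ t → - f t)      ≈⟨ ∑-cong (λ t → -1*x≈-x (f t)) ⟨
    ∑ K (λ t → - 1# * f t) ≈⟨ *-distribˡ-∑ (- 1#) f ⟨
    - 1# * ∑ K f           ≈⟨ -1*x≈-x _ ⟩
    - ∑ K f                ∎

  ∑-splitAt : ∀ d₁ {d₂} (f : Fin (d₁ + d₂) → Carrier) →
              ∑ K f ≈ ∑ K (λ t → f (t ↑ˡ d₂)) ⊕ ∑ K (λ u → f (d₁ ↑ʳ u))
  ∑-splitAt zero     f = sym (+-identityˡ _)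
  ∑-splitAt (suc d₁) f = trans (+-congˡ (∑-splitAt d₁ (f ∘ fsuc))) (sym (+-assoc _ _ _))

  ∑-*-sub : ∀ {k} (a u v : Fin k → Carrier) →
            ∑ K (λ t → a t * (u t - v t)) ≈ ∑ K (λ t → a t * u t) - ∑ K (λ t → a t * v t)
  ∑-*-sub {k} a u v = begin
    ∑ K (λ t → a t * (u t - v t))                     ≈⟨ ∑-cong {k} (λ t → x[y-z]≈xy-xz (a t) (u t) (v t)) ⟩
    ∑ K (λ t → a t * u t - a t * v t)                 ≈⟨ ∑-distrib-⊕ (λ t → a t * u t) (λ t → - (a t * v t)) ⟩
    ∑ K (λ t → a t * u t) ⊕ ∑ K (λ t → - (a t * v t)) ≈⟨ +-congˡ (∑-neg (λ t → a t * v t)) ⟩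
    ∑ K (λ t → a t * u t) - ∑ K (λ t → a t * v t)     ∎

  ∑-*-pull : ∀ {k} (a u : Fin k → Carrier) x → ∑ K (λ t → a t * (x * u t)) ≈ x * ∑ K (λ t → a t * u t)
  ∑-*-pull {k} a u x = begin
    ∑ K (λ t → a t * (x * u t)) ≈⟨ ∑-cong {k} (λ t → x∙yz≈y∙xz (a t) x (u t)) ⟩
    ∑ K (λ t → x * (a t * u t)) ≈⟨ *-distribˡ-∑ x (λ t → a t * u t) ⟨
    x * ∑ K (λ t → a t * u t)   ∎

  single : ∀ {k} → Fin k → Carrier → Fin k → Carrier
  single fzero     z fzero    = z
  single fzero     z (fsuc _) = 0#
  single (fsuc t₀) z fzero    = 0#
  single (fsuc t₀) z (fsuc t) = single t₀ z t

  single-self : ∀ {k} (t₀ : Fin k) z → single t₀ z t₀ ≡ z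
  single-self fzero     z = ≡.refl
  single-self (fsuc t₀) z = single-self t₀ z

  single-other : ∀ {k} {t₀ t : Fin k} z → t ≢ t₀ → single t₀ z t ≡ 0#
  single-other {t₀ = fzero}   {fzero}  z t≢t₀ = ⊥-elim (t≢t₀ ≡.refl)
  single-other {t₀ = fzero}   {fsuc t} z _    = ≡.refl
  single-other {t₀ = fsuc t₀} {fzero}  z _    = ≡.refl
  single-other {t₀ = fsuc t₀} {fsuc t} z t≢t₀ = single-other z (t≢t₀ ∘ ≡.cong fsuc)

  ∑-single : ∀ {k} (t₀ : Fin k) z (f : Fin k → Carrier) → ∑ K (λ t → single t₀ z t * f t) ≈ z * f t₀
  ∑-single fzero     z f = trans (+-congˡ (∑-zero (λ t → zeroˡ (f (fsuc t))))) (+-identityʳ _)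
  ∑-single (fsuc t₀) z f = trans (+-congʳ (zeroˡ (f fzero))) (trans (+-identityˡ _) (∑-single t₀ z (f ∘ fsuc)))

  Independent : ∀ {d} {I : Set} → (Fin d → I → Carrier) → Set (c ⊔ ℓ)
  Independent {d} w = ∀ (cs : Fin d → Carrier) → (∀ j → ∑ K (λ t → cs t * w t j) ≈ 0#) → ∀ t → cs t ≈ 0#

  module _ {d} {I : Set} {w : Fin d → I → Carrier} (independent : Independent w) where

    independent⇒nonzero : ∀ t → ¬ (∀ j → w t j ≈ 0#)
    independent⇒nonzero t w≈0 = 0≉1 (sym (begin
      1#                 ≡⟨ single-self t 1# ⟨
      single t 1# t      ≈⟨ independent (single t 1#) relation t ⟩
      0#                 ∎))
      where
      relation : ∀ j → ∑ K (λ u → single t 1# u * w u j) ≈ 0#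
      relation j = trans (∑-single t 1# (λ u → w u j)) (trans (*-congˡ (w≈0 j)) (zeroʳ 1#))

    independent⇒injective : ∀ t t′ → (∀ j → w t j ≈ w t′ j) → t ≡ t′
    independent⇒injective t t′ w≈w with t Fin.≟ t′
    ... | yes t≡t′ = t≡t′
    ... | no  t≢t′ = ⊥-elim (0≉1 (sym (begin
      1#                                  ≈⟨ +-identityʳ 1# ⟨
      1# ⊕ 0#                              ≡⟨ ≡.cong₂ _⊕_ (single-self t 1#) (single-other (- 1#) t≢t′) ⟨
      single t 1# t ⊕ single t′ (- 1#) t   ≈⟨ independent cs relation t ⟩
      0#                                   ∎)))
      where
      cs : Fin d → Carrier
      cs u = single t 1# u ⊕ single t′ (- 1#) u
      relation : ∀ j → ∑ K (λ u → cs u * w u j) ≈ 0#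
      relation j = begin
        ∑ K (λ u → cs u * w u j)
          ≈⟨ ∑-cong {d} (λ u → distribʳ _ _ _) ⟩
        ∑ K (λ u → single t 1# u * w u j ⊕ single t′ (- 1#) u * w u j)
          ≈⟨ ∑-distrib-⊕ (λ u → single t 1# u * w u j) (λ u → single t′ (- 1#) u * w u j) ⟩
        ∑ K (λ u → single t 1# u * w u j) ⊕ ∑ K (λ u → single t′ (- 1#) u * w u j)
          ≈⟨ +-cong (∑-single t 1# _) (∑-single t′ (- 1#) _) ⟩
        1# * w t j ⊕ - 1# * w t′ j
          ≈⟨ +-cong (*-identityˡ _) (-1*x≈-x _) ⟩
        w t j ⊕ - w t′ j
          ≈⟨ +-congˡ (-‿cong (w≈w j)) ⟨
        w t j ⊕ - w t j
          ≈⟨ -‿inverseʳ _ ⟩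
        0# ∎

  independent-fromProjection : ∀ {d} {I J : Set} {w : Fin d → I → Carrier} (w′ : Fin d → J → Carrier)
                               (φ : I → J) → (∀ t j → w t j ≈ w′ t (φ j)) → Independent w → Independent w′
  independent-fromProjection w′ φ w≈w′ independent cs relation =
    independent cs (λ j → trans (∑-cong (λ t → *-congˡ (w≈w′ t j))) (relation (φ j)))

  independent-↑ˡ : ∀ {d e} {I : Set} {w : Fin (d + e) → I → Carrier} →
                   Independent w → Independent (λ t → w (t ↑ˡ e))
  independent-↑ˡ {d} {e} {w = w} independent cs relation t =
    trans (reflexive (≡.sym (lookup-++ˡ cs zeros t))) (independent (cs Vector.++ zeros) relation′ (t ↑ˡ e))
    where
    zeros : Fin e → Carrier
    zeros _ = 0#
    relation′ : ∀ j → ∑ K (λ k → (cs Vector.++ zeros) k * w k j) ≈ 0#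
    relation′ j = begin
      ∑ K (λ k → (cs Vector.++ zeros) k * w k j)
        ≈⟨ ∑-splitAt d (λ k → (cs Vector.++ zeros) k * w k j) ⟩
      ∑ K (λ t → (cs Vector.++ zeros) (t ↑ˡ e) * w (t ↑ˡ e) j) ⊕ ∑ K (λ u → (cs Vector.++ zeros) (d ↑ʳ u) * w (d ↑ʳ u) j)
        ≈⟨ +-cong (∑-cong (λ t → *-congʳ (reflexive (lookup-++ˡ cs zeros t))))
                  (∑-zero (λ u → trans (*-congʳ (reflexive (lookup-++ʳ cs zeros u))) (zeroˡ _))) ⟩
      ∑ K (λ t → cs t * w (t ↑ˡ e) j) ⊕ 0#
        ≈⟨ +-identityʳ _ ⟩
      ∑ K (λ t → cs t * w (t ↑ˡ e) j)
        ≈⟨ relation j ⟩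
      0# ∎

  -- One step of Gaussian elimination: multiples of row 0 are subtracted from the other rows so that
  -- the pivot column j₀ vanishes below it.
  module Pivot {d n} (R : Fin (suc d) → Fin n → Carrier) (j₀ : Fin n)
               (π⁻¹ : Carrier) (π⁻¹*π≈1 : π⁻¹ * R fzero j₀ ≈ 1#) where

    scale : Fin d → Carrier
    scale i = R (fsuc i) j₀ * π⁻¹

    reduced : Fin d → Fin n → Carrier
    reduced i j = R (fsuc i) j - scale i * R fzero j

    reduced-independent : Independent R → Independent reduced
    reduced-independent independent a relation i = independent cs relation′ (fsuc i)
      where
      cs : Fin (suc d) → Carrier
      cs = - ∑ K (λ i → a i * scale i) Vector.∷ a
      relation′ : ∀ j → ∑ K (λ t → cs t * R t j) ≈ 0#
      relation′ j = begin
        - ∑ K (λ i → a i * scale i) * R fzero j ⊕ ∑ K (λ i → a i * R (fsuc i) j)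
          ≈⟨ +-comm _ _ ⟩
        ∑ K (λ i → a i * R (fsuc i) j) ⊕ - ∑ K (λ i → a i * scale i) * R fzero j
          ≈⟨ +-congˡ (trans (sym (-‿distribˡ-* _ _)) (-‿cong (trans (*-comm _ _) (sym (∑-*-pull a scale (R fzero j)))))) ⟩
        ∑ K (λ i → a i * R (fsuc i) j) - ∑ K (λ i → a i * (R fzero j * scale i))
          ≈⟨ +-congˡ (-‿cong (∑-cong {d} (λ i → *-congˡ (*-comm _ _)))) ⟩
        ∑ K (λ i → a i * R (fsuc i) j) - ∑ K (λ i → a i * (scale i * R fzero j))
          ≈⟨ ∑-*-sub a (λ i → R (fsuc i) j) (λ i → scale i * R fzero j) ⟨
        ∑ K (λ i → a i * reduced i j)
          ≈⟨ relation j ⟩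
        0# ∎

    private
      π : Carrier
      π = R fzero j₀

      scale*π : ∀ i → scale i * π ≈ R (fsuc i) j₀
      scale*π i = trans (*-assoc _ _ _) (trans (*-congˡ π⁻¹*π≈1) (*-identityʳ _))

      cancel-π : ∀ {x} → x * π ≈ 0# → x ≈ 0#
      cancel-π {x} xπ≈0 = begin
        x               ≈⟨ *-identityʳ x ⟨
        x * 1#          ≈⟨ *-congˡ π⁻¹*π≈1 ⟨
        x * (π⁻¹ * π)   ≈⟨ trans (*-congˡ (*-comm _ _)) (sym (*-assoc _ _ _)) ⟩
        x * π * π⁻¹     ≈⟨ *-congʳ xπ≈0 ⟩
        0# * π⁻¹        ≈⟨ zeroˡ π⁻¹ ⟩
        0#              ∎

    pivot-extends : ∀ {col′ : Fin d → Fin n} → Independent (λ k i → reduced i (col′ k)) →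
                    Independent (λ k t → R t ((j₀ Vector.∷ col′) k))
    pivot-extends {col′} independent′ β relation = βs≈0
      where
      β′ : Fin d → Carrier
      β′ = β ∘ fsuc
      T : Fin (suc d) → Carrier
      T t = ∑ K (λ k → β′ k * R t (col′ k))
      T≈ : ∀ t → T t ≈ - (β fzero * R t j₀)
      T≈ t = +-inverseʳ-unique (β fzero * R t j₀) (T t) (relation t)
      tail-relation : ∀ i → ∑ K (λ k → β′ k * reduced i (col′ k)) ≈ 0#
      tail-relation i = begin
        ∑ K (λ k → β′ k * reduced i (col′ k))
          ≈⟨ ∑-*-sub β′ (λ k → R (fsuc i) (col′ k)) (λ k → scale i * R fzero (col′ k)) ⟩
        T (fsuc i) - ∑ K (λ k → β′ k * (scale i * R fzero (col′ k)))
          ≈⟨ +-congˡ (-‿cong (∑-*-pull β′ (λ k → R fzero (col′ k)) (scale i))) ⟩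
        T (fsuc i) - scale i * T fzero
          ≈⟨ +-cong (T≈ (fsuc i)) (-‿cong (*-congˡ (T≈ fzero))) ⟩
        - (β fzero * R (fsuc i) j₀) - scale i * - (β fzero * π)
          ≈⟨ +-congˡ (-‿cong (sym (-‿distribʳ-* _ _))) ⟩
        - (β fzero * R (fsuc i) j₀) - - (scale i * (β fzero * π))
          ≈⟨ +-congˡ (-‿involutive _) ⟩
        - (β fzero * R (fsuc i) j₀) ⊕ scale i * (β fzero * π)
          ≈⟨ +-congˡ (trans (x∙yz≈y∙xz (scale i) (β fzero) π) (*-congˡ (scale*π i))) ⟩
        - (β fzero * R (fsuc i) j₀) ⊕ β fzero * R (fsuc i) j₀
          ≈⟨ -‿inverseˡ _ ⟩
        0# ∎
      β′≈0 : ∀ k → β′ k ≈ 0#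
      β′≈0 = independent′ β′ tail-relation
      β₀≈0 : β fzero ≈ 0#
      β₀≈0 = cancel-π (begin
        β fzero * π           ≈⟨ +-identityʳ _ ⟨
        β fzero * π ⊕ 0#      ≈⟨ +-congˡ (∑-zero (λ k → trans (*-congʳ (β′≈0 k)) (zeroˡ _))) ⟨
        β fzero * π ⊕ T fzero ≈⟨ relation fzero ⟩
        0#                    ∎)
      βs≈0 : ∀ k → β k ≈ 0#
      βs≈0 fzero    = β₀≈0
      βs≈0 (fsuc k) = β′≈0 k

  rankAtLeast : ∀ {δ m n} (A : Mat K m n) (r : Fin δ → Fin m) → Independent (λ t → A (r t)) → RankAtLeast K A δ
  rankAtLeast A r independent =
    r , (λ t t′ r≡r′ → independent⇒injective independent t t′ (λ j → reflexive (≡.cong (λ i → A i j) r≡r′)))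
      , independent

  RankAtLeast-cong : ∀ {δ m n} {A B : Mat K m n} → (∀ i j → A i j ≈ B i j) → RankAtLeast K A δ → RankAtLeast K B δ
  RankAtLeast-cong {B = B} A≈B (r , _ , independent) =
    rankAtLeast B r (independent-fromProjection (λ t → B (r t)) (λ j → j) (λ t j → A≈B (r t) j) independent)

  RankAtLeast-mono : ∀ {δ′ δ m n} (A : Mat K m n) → δ′ ≤ δ → RankAtLeast K A δ → RankAtLeast K A δ′
  RankAtLeast-mono {δ′} {δ} A δ′≤δ rank with ≡.subst (RankAtLeast K A) (≡.sym (ℕ.m+[n∸m]≡n δ′≤δ)) rank
  ... | r , _ , independent = rankAtLeast A (λ t → r (t ↑ˡ (δ ∸ δ′))) (independent-↑ˡ independent)

  SupportedIn : ∀ {m n} → Diagram m n → Mat K m n → Set ℓ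
  SupportedIn D X = ∀ i j → D i j ≡ false → X i j ≈ 0#

  lincomb-supported : ∀ {k m n} {D : Diagram m n} {B : Fin k → Mat K m n} →
                      (∀ t → SupportedIn D (B t)) → ∀ a → SupportedIn D (lincomb K a B)
  lincomb-supported B-supported a i j noDot = ∑-zero (λ t → trans (*-congˡ (B-supported t i j noDot)) (zeroʳ (a t)))

  module WithDecidableEquality (_≟_ : Decidable _≈_) where

    nonzeroEntry : ∀ {d n} {w : Fin d → Fin n → Carrier} → Independent w → ∀ t → ∃ λ j → w t j ≉ 0#
    nonzeroEntry {w = w} independent t = ¬∀⟶∃¬ _ _ (λ j → w t j ≟ 0#) (independent⇒nonzero independent t)

    independentMinor : ∀ {d n} {R : Fin d → Fin n → Carrier} → Independent R →
                       Σ (Fin d → Fin n) λ col → Independent (λ k t → R t (col k))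
    independentMinor {zero}          _           = (λ ()) , (λ _ _ ())
    independentMinor {suc d} {R = R} independent with nonzeroEntry {w = R} independent fzero
    ... | j₀ , π≉0 with inverse (R fzero j₀) π≉0
    ... | π⁻¹ , π*π⁻¹≈1 = map (j₀ Vector.∷_) pivot-extends (independentMinor (reduced-independent independent))
      where open Pivot R j₀ π⁻¹ (trans (*-comm _ _) π*π⁻¹≈1)

    isZeroMat? : ∀ {m n} (A : Mat K m n) → Dec (IsZeroMat K A)
    isZeroMat? A = all? (λ i → all? (λ j → A i j ≟ 0#))

  record Split {δ} (P : Fin δ → Bool) : Set (c ⊔ ℓ) where
    field
      d₁ d₂        : ℕ
      d₁+d₂≡δ      : d₁ + d₂ ≡ δ
      embed₁       : Fin d₁ → Fin δ
      embed₂       : Fin d₂ → Fin δ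
      embed₁-true  : ∀ t → P (embed₁ t) ≡ true
      embed₂-false : ∀ u → P (embed₂ u) ≡ false
      merge        : (Fin d₁ → Carrier) → (Fin d₂ → Carrier) → Fin δ → Carrier
      merge-embed₁ : ∀ a b t → merge a b (embed₁ t) ≡ a t
      merge-embed₂ : ∀ a b u → merge a b (embed₂ u) ≡ b u
      ∑-split      : ∀ f → ∑ K f ≈ ∑ K (f ∘ embed₁) ⊕ ∑ K (f ∘ embed₂)

  split : ∀ {δ} (P : Fin δ → Bool) → Split P
  split {zero} P = record
    { d₁ = 0 ; d₂ = 0 ; d₁+d₂≡δ = ≡.refl ; embed₁ = λ () ; embed₂ = λ () ; embed₁-true = λ () ; embed₂-false = λ ()
    ; merge = λ _ _ () ; merge-embed₁ = λ _ _ () ; merge-embed₂ = λ _ _ () ; ∑-split = λ _ → sym (+-identityˡ 0#) }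
  split {suc δ} P with P fzero in P₀
  ... | true = record
    { d₁ = suc d₁ ; d₂ = d₂ ; d₁+d₂≡δ = ≡.cong suc d₁+d₂≡δ
    ; embed₁ = fzero Vector.∷ fsuc ∘ embed₁ ; embed₂ = fsuc ∘ embed₂
    ; embed₁-true = λ { fzero → P₀ ; (fsuc t) → embed₁-true t } ; embed₂-false = embed₂-false
    ; merge = λ a b → a fzero Vector.∷ merge (a ∘ fsuc) b
    ; merge-embed₁ = λ { a b fzero → ≡.refl ; a b (fsuc t) → merge-embed₁ (a ∘ fsuc) b t }
    ; merge-embed₂ = λ a b → merge-embed₂ (a ∘ fsuc) b
    ; ∑-split = λ f → trans (+-congˡ (∑-split (f ∘ fsuc))) (sym (+-assoc _ _ _)) }
    where open Split (split (P ∘ fsuc))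
  ... | false = record
    { d₁ = d₁ ; d₂ = suc d₂ ; d₁+d₂≡δ = ≡.trans (ℕ.+-suc d₁ d₂) (≡.cong suc d₁+d₂≡δ)
    ; embed₁ = fsuc ∘ embed₁ ; embed₂ = fzero Vector.∷ fsuc ∘ embed₂
    ; embed₁-true = embed₁-true ; embed₂-false = λ { fzero → P₀ ; (fsuc u) → embed₂-false u }
    ; merge = λ a b → b fzero Vector.∷ merge a (b ∘ fsuc)
    ; merge-embed₁ = λ a b → merge-embed₁ a (b ∘ fsuc)
    ; merge-embed₂ = λ { a b fzero → ≡.refl ; a b (fsuc u) → merge-embed₂ a (b ∘ fsuc) u }
    ; ∑-split = λ f → trans (+-congˡ (∑-split (f ∘ fsuc))) (x⊕[y⊕z]≈y⊕[x⊕z] _ _ _) }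
    where
    open Split (split (P ∘ fsuc))

-- Laying out line data on F

eqℕ-refl : ∀ a → eqℕ a a ≡ true
eqℕ-refl zero    = ≡.refl
eqℕ-refl (suc a) = eqℕ-refl a

<⇒eqℕ≡false : ∀ {a b} → a < b → eqℕ a b ≡ false
<⇒eqℕ≡false {zero}  (s≤s _)   = ≡.refl
<⇒eqℕ≡false {suc a} (s≤s a<b) = <⇒eqℕ≡false a<b

eqℕ-suc-opposite : ∀ {n} (c : Fin n) → eqℕ (suc (toℕ (opposite c))) n ≡ isZero (toℕ c)
eqℕ-suc-opposite {suc n} fzero    = ≡.trans (≡.cong (λ k → eqℕ k n) (toℕ-fromℕ n)) (eqℕ-refl n)
eqℕ-suc-opposite {suc n} (fsuc c) = <⇒eqℕ≡false (≡.subst (_< n) (≡.sym (toℕ-inject₁ (opposite c))) (toℕ<n (opposite c)))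

-- The lines of F that receive a column of F₁₂₃: the cell (m₁, n₁ − 1) of F₂, the rows of F₁ and
-- the columns of F₃.
data Line (m₁ n₃ : ℕ) : Set where
  corner : Line m₁ n₃
  row    : Fin m₁ → Line m₁ n₃
  column : Fin n₃ → Line m₁ n₃

lineLength : ∀ {m₁ n₁ m₃ n₃} → Diagram m₁ n₁ → Diagram m₃ n₃ → Line m₁ n₃ → ℕ
lineLength F₁ F₃ corner     = 1
lineLength F₁ F₃ (row i)    = rowCount F₁ i
lineLength F₁ F₃ (column j) = colCount F₃ j

isRow : ∀ {m₁ n₃} → Line m₁ n₃ → Bool
isRow (row _) = true
isRow _       = false

rowIndex : ∀ {m₁ n₃} (x : Line m₁ n₃) → isRow x ≡ true → Fin m₁
rowIndex (row i) _ = i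

rowIndex-row : ∀ {m₁ n₃} (x : Line m₁ n₃) (x-row : isRow x ≡ true) → x ≡ row (rowIndex x x-row)
rowIndex-row (row i) _ = ≡.refl

_≟corner : ∀ {m₁ n₃} (x : Line m₁ n₃) → Dec (x ≡ corner)
corner     ≟corner = yes ≡.refl
(row _)    ≟corner = no λ ()
(column _) ≟corner = no λ ()

module Layout {c ℓ} (K : Field c ℓ) (m₁ n₁ m₃ n₃ : ℕ) where

  open Field K renaming (_+_ to _⊕_)
  open LinearAlgebra K
  open import Relation.Binary.Reasoning.Setoid setoid

  isLast : Fin n₁ → Bool
  isLast c = eqℕ (suc (toℕ c)) n₁

  LineData : Set c
  LineData = Line m₁ n₃ → ℕ → Carrier

  -- Entry r of a line is counted from where its dots start: from the right end along a row of F₁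
  -- (whose dots are right-aligned) and from the top down a column of F₃. The corner line is laid
  -- out like a column at position n₁ − 1 of the bottom block; only its entry 0 lies in F.
  layoutBlock : LineData → Fin m₁ ⊎ Fin m₃ → Fin n₁ ⊎ Fin n₃ → Carrier
  layoutBlock v (inj₁ i) (inj₁ c) = v (row i) (toℕ (opposite c))
  layoutBlock v (inj₁ i) (inj₂ j) = 0#
  layoutBlock v (inj₂ s) (inj₁ c) = if isLast c then v corner (toℕ s) else 0#
  layoutBlock v (inj₂ s) (inj₂ j) = v (column j) (toℕ s)

  layout : LineData → Mat K (m₁ + m₃) (n₁ + n₃)
  layout v i j = layoutBlock v (splitAt m₁ i) (splitAt n₁ j)

  topRightBlock : Mat K m₁ n₃ → Fin m₁ ⊎ Fin m₃ → Fin n₁ ⊎ Fin n₃ → Carrier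
  topRightBlock Y (inj₁ i) (inj₂ j) = Y i j
  topRightBlock Y (inj₁ i) (inj₁ c) = 0#
  topRightBlock Y (inj₂ s) _        = 0#

  topRight : Mat K m₁ n₃ → Mat K (m₁ + m₃) (n₁ + n₃)
  topRight Y i j = topRightBlock Y (splitAt m₁ i) (splitAt n₁ j)

  module _ (v : LineData) where

    layout-row : ∀ i c → layout v (i ↑ˡ m₃) (c ↑ˡ n₃) ≡ v (row i) (toℕ (opposite c))
    layout-row i c = ≡.cong₂ (layoutBlock v) (splitAt-↑ˡ m₁ i m₃) (splitAt-↑ˡ n₁ c n₃)

    layout-topRight : ∀ i j → layout v (i ↑ˡ m₃) (n₁ ↑ʳ j) ≡ 0#
    layout-topRight i j = ≡.cong₂ (layoutBlock v) (splitAt-↑ˡ m₁ i m₃) (splitAt-↑ʳ n₁ n₃ j)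

    layout-bottomLeft : ∀ s c → layout v (m₁ ↑ʳ s) (c ↑ˡ n₃) ≡ (if isLast c then v corner (toℕ s) else 0#)
    layout-bottomLeft s c = ≡.cong₂ (layoutBlock v) (splitAt-↑ʳ m₁ m₃ s) (splitAt-↑ˡ n₁ c n₃)

    layout-column : ∀ s j → layout v (m₁ ↑ʳ s) (n₁ ↑ʳ j) ≡ v (column j) (toℕ s)
    layout-column s j = ≡.cong₂ (layoutBlock v) (splitAt-↑ʳ m₁ m₃ s) (splitAt-↑ʳ n₁ n₃ j)

  topRight-topRight : ∀ Y i j → topRight Y (i ↑ˡ m₃) (n₁ ↑ʳ j) ≡ Y i j
  topRight-topRight Y i j = ≡.cong₂ (topRightBlock Y) (splitAt-↑ˡ m₁ i m₃) (splitAt-↑ʳ n₁ n₃ j)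

  reversed : ∀ {r} → r < n₁ → Fin n₁
  reversed r<n₁ = opposite (fromℕ< r<n₁)

  toℕ-opposite-reversed : ∀ {r} (r<n₁ : r < n₁) → toℕ (opposite (reversed r<n₁)) ≡ r
  toℕ-opposite-reversed r<n₁ = ≡.trans (≡.cong toℕ (opposite-involutive (fromℕ< r<n₁))) (toℕ-fromℕ< r<n₁)

  isLast-reversed : ∀ {r} (r<n₁ : r < n₁) → isLast (reversed r<n₁) ≡ isZero r
  isLast-reversed r<n₁ = ≡.trans (eqℕ-suc-opposite (fromℕ< r<n₁)) (≡.cong isZero (toℕ-fromℕ< r<n₁))

  layout-reversed : ∀ v i {r} (r<n₁ : r < n₁) → layout v (i ↑ˡ m₃) (reversed r<n₁ ↑ˡ n₃) ≡ v (row i) r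
  layout-reversed v i r<n₁ = ≡.trans (layout-row v i (reversed r<n₁)) (≡.cong (v (row i)) (toℕ-opposite-reversed r<n₁))

  layout-corner : ∀ v (1≤n₁ : 1 ≤ n₁) s → layout v (m₁ ↑ʳ s) (reversed 1≤n₁ ↑ˡ n₃) ≡ v corner (toℕ s)
  layout-corner v 1≤n₁ s = ≡.trans (layout-bottomLeft v s (reversed 1≤n₁))
                                   (≡.cong (if_then v corner (toℕ s) else 0#) (isLast-reversed 1≤n₁))

  private
    ∑-*0 : ∀ {k} (a : Fin k → Carrier) → ∑ K (λ t → a t * 0#) ≈ 0#
    ∑-*0 a = ∑-zero (λ t → zeroʳ (a t))

  layout-linear : ∀ {k} (a : Fin k → Carrier) (v : Fin k → LineData) i j →
                  ∑ K (λ t → a t * layout (v t) i j) ≈ layout (λ x r → ∑ K (λ t → a t * v t x r)) i j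
  layout-linear a v i j with splitAt m₁ i | splitAt n₁ j
  ... | inj₁ _ | inj₁ _ = refl
  ... | inj₁ _ | inj₂ _ = ∑-*0 a
  ... | inj₂ _ | inj₂ _ = refl
  ... | inj₂ _ | inj₁ c with isLast c
  ...   | true  = refl
  ...   | false = ∑-*0 a

  layout-cong : ∀ {v w} → (∀ x r → v x r ≈ w x r) → ∀ i j → layout v i j ≈ layout w i j
  layout-cong v≈w i j with splitAt m₁ i | splitAt n₁ j
  ... | inj₁ _ | inj₁ _ = v≈w _ _
  ... | inj₁ _ | inj₂ _ = refl
  ... | inj₂ _ | inj₂ _ = v≈w _ _
  ... | inj₂ _ | inj₁ c with isLast c
  ...   | true  = v≈w _ _
  ...   | false = refl

  topRight-linear : ∀ {k} (a : Fin k → Carrier) (Y : Fin k → Mat K m₁ n₃) i j →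
                    ∑ K (λ t → a t * topRight (Y t) i j) ≈ topRight (lincomb K a Y) i j
  topRight-linear a Y i j with splitAt m₁ i | splitAt n₁ j
  ... | inj₁ _ | inj₂ _ = refl
  ... | inj₁ _ | inj₁ _ = ∑-*0 a
  ... | inj₂ _ | _      = ∑-*0 a

  layout-zero : ∀ {v} → (∀ x r → v x r ≈ 0#) → IsZeroMat K (layout v)
  layout-zero {v} v≈0 i j with splitAt m₁ i | splitAt n₁ j
  ... | inj₁ _ | inj₁ _ = v≈0 _ _
  ... | inj₁ _ | inj₂ _ = refl
  ... | inj₂ _ | inj₂ _ = v≈0 _ _
  ... | inj₂ _ | inj₁ c with isLast c
  ...   | true  = v≈0 _ _
  ...   | false = refl

  topRight-zero : ∀ {Y} → IsZeroMat K Y → IsZeroMat K (topRight Y)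
  topRight-zero {Y} Y≈0 i j with splitAt m₁ i | splitAt n₁ j
  ... | inj₁ _ | inj₂ _ = Y≈0 _ _
  ... | inj₁ _ | inj₁ _ = refl
  ... | inj₂ _ | _      = refl

  topRight-supported : ∀ {F₁ F₃} Y i j → compose F₁ (full m₁ n₃) F₃ i j ≡ false → topRight Y i j ≈ 0#
  topRight-supported Y i j noDot with splitAt m₁ i | splitAt n₁ j
  ... | inj₁ _ | inj₁ _ = refl
  ... | inj₂ _ | _      = refl

  Supported : (Line m₁ n₃ → ℕ) → LineData → Set ℓ
  Supported length v = ∀ x r → length x ≤ r → v x r ≈ 0#

  layout-supported : ∀ {F₁ F₃ v} → IsFerrers F₁ → IsFerrers F₃ → Supported (lineLength F₁ F₃) v →
                     ∀ i j → compose F₁ (full m₁ n₃) F₃ i j ≡ false → layout v i j ≈ 0#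
  layout-supported {F₁} {F₃} {v} F₁-ferrers F₃-ferrers supported i j noDot with splitAt m₁ i | splitAt n₁ j
  ... | inj₁ i | inj₁ c = supported (row i) _
                            (≡.subst (_ ≤_) (≡.sym (opposite-prop c)) (Ferrers.noDot⇒rowCount≤ F₁-ferrers noDot))
  ... | inj₂ s | inj₂ j = supported (column j) _ (Ferrers.noDot⇒colCount≤ F₃-ferrers noDot)
  ... | inj₂ s | inj₁ c with isLast c | toℕ s
  ...   | false | _     = refl
  ...   | true  | suc r = supported corner (suc r) (s≤s z≤n)

  record Fits (v : LineData) : Set ℓ where
    field
      corner-fits : ∀ r → 1 ≤ r → v corner r ≈ 0#
      row-fits    : ∀ i r → n₁ ≤ r → v (row i) r ≈ 0#
      column-fits : ∀ j r → m₃ ≤ r → v (column j) r ≈ 0#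

  supported⇒fits : ∀ {F₁ F₃ v} → Supported (lineLength F₁ F₃) v → Fits v
  supported⇒fits {F₁} {F₃} supported = record
    { corner-fits = supported corner
    ; row-fits    = λ i r n₁≤r → supported (row i) r (ℕ.≤-trans (count≤n (F₁ i)) n₁≤r)
    ; column-fits = λ j r m₃≤r → supported (column j) r (ℕ.≤-trans (count≤n (λ s → F₃ s j)) m₃≤r)
    }

  layout-faithful : ∀ {v} → 1 ≤ n₁ → 1 ≤ m₃ → Fits v → IsZeroMat K (layout v) → ∀ x r → v x r ≈ 0#
  layout-faithful {v} 1≤n₁ 1≤m₃ fits layout≈0 = vanishes
    where
    open Fits fits
    vanishes : ∀ x r → v x r ≈ 0#
    vanishes corner zero = begin
      v corner 0                                                  ≡⟨ ≡.cong (v corner) (toℕ-fromℕ< 1≤m₃) ⟨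
      v corner (toℕ (fromℕ< 1≤m₃))                                ≡⟨ layout-corner v 1≤n₁ (fromℕ< 1≤m₃) ⟨
      layout v (m₁ ↑ʳ fromℕ< 1≤m₃) (reversed 1≤n₁ ↑ˡ n₃)          ≈⟨ layout≈0 _ _ ⟩
      0#                                                          ∎
    vanishes corner (suc r) = corner-fits (suc r) (s≤s z≤n)
    vanishes (row i) r with r <? n₁
    ... | yes r<n₁ = trans (reflexive (≡.sym (layout-reversed v i r<n₁))) (layout≈0 _ _)
    ... | no  r≮n₁ = row-fits i r (ℕ.≮⇒≥ r≮n₁)
    vanishes (column j) r with r <? m₃
    ... | yes r<m₃ = begin
      v (column j) r                                 ≡⟨ ≡.cong (v (column j)) (toℕ-fromℕ< r<m₃) ⟨
      v (column j) (toℕ (fromℕ< r<m₃))               ≡⟨ layout-column v (fromℕ< r<m₃) j ⟨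
      layout v (m₁ ↑ʳ fromℕ< r<m₃) (n₁ ↑ʳ j)          ≈⟨ layout≈0 _ _ ⟩
      0#                                              ∎
    ... | no  r≮m₃ = column-fits j r (ℕ.≮⇒≥ r≮m₃)

module LayoutRank {c ℓ} (K : Field c ℓ) (_≟_ : Decidable (Field._≈_ K)) {m₁ n₁ m₃ n₃ : ℕ}
                  (1≤n₁ : 1 ≤ n₁) (1≤m₃ : 1 ≤ m₃) where

  open Field K renaming (_+_ to _⊕_)
  open RingProperties ring using (-‿distribˡ-*)
  open LinearAlgebra K
  open WithDecidableEquality _≟_
  open Layout K m₁ n₁ m₃ n₃
  open import Relation.Binary.Reasoning.Setoid setoid

  columnPosition : ∀ (x : Line m₁ n₃) → isRow x ≡ false → Fin (n₁ + n₃)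
  columnPosition corner     _ = reversed 1≤n₁ ↑ˡ n₃
  columnPosition (column j) _ = n₁ ↑ʳ j

  layout-columnPosition : ∀ v (x : Line m₁ n₃) (x-col : isRow x ≡ false) s →
                          layout v (m₁ ↑ʳ s) (columnPosition x x-col) ≡ v x (toℕ s)
  layout-columnPosition v corner     _ s = layout-corner v 1≤n₁ s
  layout-columnPosition v (column j) _ s = layout-column v s j

  nonRow-fits : ∀ {v} → Fits v → ∀ (x : Line m₁ n₃) → isRow x ≡ false → ∀ r → m₃ ≤ r → v x r ≈ 0#
  nonRow-fits fits corner     _ r m₃≤r = Fits.corner-fits fits r (ℕ.≤-trans 1≤m₃ m₃≤r)
  nonRow-fits fits (column j) _ r m₃≤r = Fits.column-fits fits j r m₃≤r

  module _ {v : LineData} (fits : Fits v) {δ} (line : Fin δ → Line m₁ n₃)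
           (independent : Independent (λ k → v (line k))) where

    open Fits fits
    open Split (split (isRow ∘ line))

    rowOf : Fin d₁ → Fin m₁
    rowOf t = rowIndex (line (embed₁ t)) (embed₁-true t)

    line-rowOf : ∀ t → line (embed₁ t) ≡ row (rowOf t)
    line-rowOf t = rowIndex-row (line (embed₁ t)) (embed₁-true t)

    position : Fin d₂ → Fin (n₁ + n₃)
    position u = columnPosition (line (embed₂ u)) (embed₂-false u)

    Relation : (Fin d₁ → Carrier) → (Fin d₂ → Carrier) → ℕ → Carrier
    Relation a b r = ∑ K (λ t → a t * v (line (embed₁ t)) r) ⊕ ∑ K (λ u → b u * v (line (embed₂ u)) r)

    parts-independent : ∀ a b → (∀ r → Relation a b r ≈ 0#) → (∀ t → a t ≈ 0#) × (∀ u → b u ≈ 0#)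
    parts-independent a b relation =
      (λ t → trans (reflexive (≡.sym (merge-embed₁ a b t))) (merged≈0 (embed₁ t))) ,
      (λ u → trans (reflexive (≡.sym (merge-embed₂ a b u))) (merged≈0 (embed₂ u)))
      where
      merged≈0 : ∀ k → merge a b k ≈ 0#
      merged≈0 = independent (merge a b) λ r → begin
        ∑ K (λ k → merge a b k * v (line k) r)
          ≈⟨ ∑-split (λ k → merge a b k * v (line k) r) ⟩
        ∑ K (λ t → merge a b (embed₁ t) * v (line (embed₁ t)) r) ⊕ ∑ K (λ u → merge a b (embed₂ u) * v (line (embed₂ u)) r)
          ≈⟨ +-cong (∑-cong (λ t → *-congʳ (reflexive (merge-embed₁ a b t))))
                    (∑-cong (λ u → *-congʳ (reflexive (merge-embed₂ a b u)))) ⟩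
        Relation a b r
          ≈⟨ relation r ⟩
        0# ∎

    -- The bottom block of the layout, restricted to the columns of the lines that are not rows.
    Λ : Fin d₂ → Fin m₃ → Carrier
    Λ u s = v (line (embed₂ u)) (toℕ s)

    Λ-independent : Independent Λ
    Λ-independent b relation = proj₂ (parts-independent (λ _ → 0#) b relation′)
      where
      relation′ : ∀ r → Relation (λ _ → 0#) b r ≈ 0#
      relation′ r = trans (+-cong (∑-zero {d₁} (λ t → zeroˡ _)) (vanish r)) (+-identityʳ 0#)
        where
        vanish : ∀ r → ∑ K (λ u → b u * v (line (embed₂ u)) r) ≈ 0#
        vanish r with r <? m₃
        ... | yes r<m₃ = trans (∑-cong λ u → *-congˡ (reflexive (≡.cong (v (line (embed₂ u))) (≡.sym (toℕ-fromℕ< r<m₃)))))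
                               (relation (fromℕ< r<m₃))
        ... | no  r≮m₃ = ∑-zero (λ u → trans (*-congˡ (nonRow-fits fits _ (embed₂-false u) r (ℕ.≮⇒≥ r≮m₃))) (zeroʳ _))

    bottomRow : Fin d₂ → Fin m₃
    bottomRow = proj₁ (independentMinor Λ-independent)

    minor-independent : Independent (λ w u → Λ u (bottomRow w))
    minor-independent = proj₂ (independentMinor Λ-independent)

    selectedRow : Fin (d₁ + d₂) → Fin (m₁ + m₃)
    selectedRow = (λ t → rowOf t ↑ˡ m₃) Vector.++ (λ w → m₁ ↑ʳ bottomRow w)

    selectedRow-top : ∀ t → selectedRow (t ↑ˡ d₂) ≡ rowOf t ↑ˡ m₃
    selectedRow-top = lookup-++ˡ (λ t → rowOf t ↑ˡ m₃) (λ w → m₁ ↑ʳ bottomRow w)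

    selectedRow-bottom : ∀ w → selectedRow (d₁ ↑ʳ w) ≡ m₁ ↑ʳ bottomRow w
    selectedRow-bottom = lookup-++ʳ (λ t → rowOf t ↑ˡ m₃) (λ w → m₁ ↑ʳ bottomRow w)

    corner-entry≉0 : ∀ u₀ → line (embed₂ u₀) ≡ corner → v corner 0 ≉ 0#
    corner-entry≉0 u₀ u₀-corner x≈0 =
      independent⇒nonzero independent (embed₂ u₀) (≡.subst (λ z → ∀ r → v z r ≈ 0#) (≡.sym u₀-corner) corner≈0)
      where
      corner≈0 : ∀ r → v corner r ≈ 0#
      corner≈0 zero    = x≈0
      corner≈0 (suc r) = corner-fits (suc r) (s≤s z≤n)

    module Combination (γ : Fin (d₁ + d₂) → Carrier)
                       (relation : ∀ j → ∑ K (λ k → γ k * layout v (selectedRow k) j) ≈ 0#) where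

      γ₁ : Fin d₁ → Carrier
      γ₁ t = γ (t ↑ˡ d₂)

      γ₂ : Fin d₂ → Carrier
      γ₂ w = γ (d₁ ↑ʳ w)

      top bottom : Fin (n₁ + n₃) → Carrier
      top    j = ∑ K (λ t → γ₁ t * layout v (rowOf t ↑ˡ m₃) j)
      bottom j = ∑ K (λ w → γ₂ w * layout v (m₁ ↑ʳ bottomRow w) j)

      top+bottom≈0 : ∀ j → top j ⊕ bottom j ≈ 0#
      top+bottom≈0 j = begin
        top j ⊕ bottom j
          ≈⟨ +-cong (∑-cong {d₁} (λ t → *-congˡ (reflexive (≡.cong (λ i → layout v i j) (selectedRow-top t)))))
                    (∑-cong {d₂} (λ w → *-congˡ (reflexive (≡.cong (λ i → layout v i j) (selectedRow-bottom w))))) ⟨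
        ∑ K (λ t → γ₁ t * layout v (selectedRow (t ↑ˡ d₂)) j) ⊕ ∑ K (λ w → γ₂ w * layout v (selectedRow (d₁ ↑ʳ w)) j)
          ≈⟨ ∑-splitAt d₁ (λ k → γ k * layout v (selectedRow k) j) ⟨
        ∑ K (λ k → γ k * layout v (selectedRow k) j)
          ≈⟨ relation j ⟩
        0# ∎

      y : ℕ → Carrier
      y r = ∑ K (λ t → γ₁ t * v (line (embed₁ t)) r)

      top-right : ∀ j → top (n₁ ↑ʳ j) ≈ 0#
      top-right j = ∑-zero (λ t → trans (*-congˡ (reflexive (layout-topRight v (rowOf t) j))) (zeroʳ _))

      top-reversed : ∀ {r} (r<n₁ : r < n₁) → top (reversed r<n₁ ↑ˡ n₃) ≈ y r
      top-reversed r<n₁ = ∑-cong (λ t → *-congˡ (reflexive (≡.trans (layout-reversed v (rowOf t) r<n₁)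
                                   (≡.cong (λ x → v x _) (≡.sym (line-rowOf t))))))

      y-fits : ∀ r → n₁ ≤ r → y r ≈ 0#
      y-fits r n₁≤r = ∑-zero (λ t → trans (*-congˡ (trans (reflexive (≡.cong (λ x → v x r) (line-rowOf t)))
                                                          (row-fits (rowOf t) r n₁≤r))) (zeroʳ _))

      bottom-reversed : ∀ {r} (r<n₁ : r < n₁) → 1 ≤ r → bottom (reversed r<n₁ ↑ˡ n₃) ≈ 0#
      bottom-reversed {suc r} r<n₁ _ = ∑-zero (λ w → trans (*-congˡ (reflexive (≡.trans
        (layout-bottomLeft v (bottomRow w) (reversed r<n₁))
        (≡.cong (if_then v corner (toℕ (bottomRow w)) else 0#) (isLast-reversed r<n₁))))) (zeroʳ _))

      bottom-position : ∀ u → bottom (position u) ≈ ∑ K (λ w → γ₂ w * Λ u (bottomRow w))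
      bottom-position u = ∑-cong (λ w → *-congˡ (reflexive (layout-columnPosition v _ (embed₂-false u) (bottomRow w))))

      γ₂-vanishes : (∀ u → top (position u) ≈ 0#) → ∀ w → γ₂ w ≈ 0#
      γ₂-vanishes top≈0 = minor-independent γ₂ λ u →
        trans (sym (bottom-position u)) (⊕≈0-cancelˡ (top≈0 u) (top+bottom≈0 (position u)))

      γ₁-vanishes : ∀ b → (∀ r → Relation γ₁ b r ≈ 0#) → ∀ t → γ₁ t ≈ 0#
      γ₁-vanishes b relation′ = proj₁ (parts-independent γ₁ b relation′)

      top-vanishes-if-γ₁ : (∀ t → γ₁ t ≈ 0#) → ∀ j → top j ≈ 0#
      top-vanishes-if-γ₁ γ₁≈0 j = ∑-zero (λ t → trans (*-congʳ (γ₁≈0 t)) (zeroˡ _))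

      top-vanishes-if-γ₂ : (∀ w → γ₂ w ≈ 0#) → ∀ j → top j ≈ 0#
      top-vanishes-if-γ₂ γ₂≈0 j = ⊕≈0-cancelʳ (∑-zero (λ w → trans (*-congʳ (γ₂≈0 w)) (zeroˡ _))) (top+bottom≈0 j)

      y-vanishes : (∀ j → top j ≈ 0#) → ∀ r → y r ≈ 0#
      y-vanishes top≈0 r with r <? n₁
      ... | yes r<n₁ = trans (sym (top-reversed r<n₁)) (top≈0 _)
      ... | no  r≮n₁ = y-fits r (ℕ.≮⇒≥ r≮n₁)

      without-corner : (∀ u → line (embed₂ u) ≢ corner) → (∀ t → γ₁ t ≈ 0#) × (∀ w → γ₂ w ≈ 0#)
      without-corner no-corner = γ₁≈0 , γ₂≈0
        where
        top-position : ∀ x (x-col : isRow x ≡ false) → x ≢ corner → top (columnPosition x x-col) ≈ 0#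
        top-position corner     _ x≢corner = ⊥-elim (x≢corner ≡.refl)
        top-position (column j) _ _        = top-right j
        γ₂≈0 : ∀ w → γ₂ w ≈ 0#
        γ₂≈0 = γ₂-vanishes (λ u → top-position _ (embed₂-false u) (no-corner u))
        γ₁≈0 : ∀ t → γ₁ t ≈ 0#
        γ₁≈0 = γ₁-vanishes (λ _ → 0#) λ r →
          trans (+-cong (y-vanishes (top-vanishes-if-γ₂ γ₂≈0) r) (∑-zero {d₂} (λ u → zeroˡ _))) (+-identityʳ 0#)

      -- With the corner among the chosen lines, y is concentrated at 0 like the corner's data, and a
      -- suitable multiple of the corner's data turns y into a relation among the chosen lines.
      with-corner : ∀ u₀ → line (embed₂ u₀) ≡ corner → (∀ t → γ₁ t ≈ 0#) × (∀ w → γ₂ w ≈ 0#)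
      with-corner u₀ u₀-corner = γ₁≈0 , γ₂-vanishes (λ u → top-vanishes-if-γ₁ γ₁≈0 (position u))
        where
        y-above : ∀ r → 1 ≤ r → y r ≈ 0#
        y-above r 1≤r with r <? n₁
        ... | yes r<n₁ = trans (sym (top-reversed r<n₁)) (⊕≈0-cancelʳ (bottom-reversed r<n₁ 1≤r) (top+bottom≈0 _))
        ... | no  r≮n₁ = y-fits r (ℕ.≮⇒≥ r≮n₁)
        x : Carrier
        x = v corner 0
        x≉0 : x ≉ 0#
        x≉0 = corner-entry≉0 u₀ u₀-corner
        x⁻¹ : Carrier
        x⁻¹ = proj₁ (inverse x x≉0)
        b : Fin d₂ → Carrier
        b = single u₀ (- (y 0 * x⁻¹))
        relation′ : ∀ r → Relation γ₁ b r ≈ 0#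
        relation′ r = trans (+-congˡ (trans (∑-single u₀ _ (λ u → v (line (embed₂ u)) r))
                                            (*-congˡ (reflexive (≡.cong (λ z → v z r) u₀-corner))))) (at r)
          where
          at : ∀ r → y r ⊕ - (y 0 * x⁻¹) * v corner r ≈ 0#
          at zero = begin
            y 0 ⊕ - (y 0 * x⁻¹) * x     ≈⟨ +-congˡ (sym (-‿distribˡ-* _ _)) ⟩
            y 0 - y 0 * x⁻¹ * x         ≈⟨ +-congˡ (-‿cong (*-assoc _ _ _)) ⟩
            y 0 - y 0 * (x⁻¹ * x)       ≈⟨ +-congˡ (-‿cong (*-congˡ (trans (*-comm _ _) (proj₂ (inverse x x≉0))))) ⟩
            y 0 - y 0 * 1#              ≈⟨ +-congˡ (-‿cong (*-identityʳ _)) ⟩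
            y 0 - y 0                   ≈⟨ -‿inverseʳ _ ⟩
            0#                          ∎
          at (suc r) = trans (+-cong (y-above (suc r) (s≤s z≤n)) (trans (*-congˡ (corner-fits (suc r) (s≤s z≤n))) (zeroʳ _)))
                             (+-identityʳ 0#)
        γ₁≈0 : ∀ t → γ₁ t ≈ 0#
        γ₁≈0 = γ₁-vanishes b relation′

      vanishes : ∀ k → γ k ≈ 0#
      vanishes = uncurry (∀-splitAt d₁) parts-vanish
        where
        parts-vanish : (∀ t → γ₁ t ≈ 0#) × (∀ w → γ₂ w ≈ 0#)
        parts-vanish with any? (λ u → line (embed₂ u) ≟corner)
        ... | yes (u₀ , u₀-corner) = with-corner u₀ u₀-corner
        ... | no  no-corner        = without-corner (λ u eq → no-corner (u , eq))

    layout-rank : RankAtLeast K (layout v) δ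
    layout-rank = ≡.subst (RankAtLeast K (layout v)) d₁+d₂≡δ
                    (rankAtLeast (layout v) selectedRow (λ γ relation → Combination.vanishes γ relation))

-- Codes on F from codes on F₁₂₃ and F₄

record ColumnAssignment {Line : Set} {M N} (length : Line → ℕ) (G : Diagram M N) : Set where
  field
    κ       : Line → Fin N
    bounded : ∀ x r → Dot G r (κ x) → toℕ r < length x
    covers  : ∀ r l → Dot G r l → ∃ λ x → κ x ≡ l

module Padding {c ℓ} (K : Field c ℓ) where

  open Field K renaming (_+_ to _⊕_)
  open LinearAlgebra K

  padded : ∀ {M} → (Fin M → Carrier) → ℕ → Carrier
  padded {M} u r with r <? M
  ... | yes r<M = u (fromℕ< r<M)
  ... | no  _   = 0#

  padded-toℕ : ∀ {M} (u : Fin M → Carrier) r → padded u (toℕ r) ≡ u r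
  padded-toℕ {M} u r with toℕ r <? M
  ... | yes r<M = ≡.cong u (fromℕ<-toℕ r r<M)
  ... | no  r≮M = ⊥-elim (r≮M (toℕ<n r))

  padded-linear : ∀ {k M} (a : Fin k → Carrier) (u : Fin k → Fin M → Carrier) r →
                  ∑ K (λ t → a t * padded (u t) r) ≈ padded (λ i → ∑ K (λ t → a t * u t i)) r
  padded-linear {M = M} a u r with r <? M
  ... | yes _ = refl
  ... | no  _ = ∑-zero (λ t → zeroʳ (a t))

  padded-zero : ∀ {M} {u : Fin M → Carrier} → (∀ i → u i ≈ 0#) → ∀ r → padded u r ≈ 0#
  padded-zero {M} u≈0 r with r <? M
  ... | yes _ = u≈0 _
  ... | no  _ = refl

module Transfer {c ℓ} (K : Field c ℓ) (_≟_ : Decidable (Field._≈_ K))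
                {m₁ n₁ m₃ n₃ : ℕ} (1≤n₁ : 1 ≤ n₁) (1≤m₃ : 1 ≤ m₃)
                {F₁ : Diagram m₁ n₁} {F₃ : Diagram m₃ n₃} (F₁-ferrers : IsFerrers F₁) (F₃-ferrers : IsFerrers F₃)
                {M N} {G : Diagram M N} (assignment : ColumnAssignment (lineLength F₁ F₃) G) where

  open Field K renaming (_+_ to _⊕_)
  open LinearAlgebra K
  open WithDecidableEquality _≟_
  open Padding K
  open Layout K m₁ n₁ m₃ n₃
  open ColumnAssignment assignment
  open import Relation.Binary.Reasoning.Setoid setoid

  lineData : Mat K M N → LineData
  lineData X x = padded (λ r → X r (κ x))

  transfer : Mat K M N → Mat K (m₁ + m₃) (n₁ + n₃)
  transfer X = layout (lineData X)

  lineData-supported : ∀ {X} → SupportedIn G X → Supported (lineLength F₁ F₃) (lineData X)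
  lineData-supported {X} X-supported x r length≤r with r <? M
  ... | no  _   = refl
  ... | yes r<M with G (fromℕ< r<M) (κ x) in dot
  ...   | false = X-supported _ _ dot
  ...   | true  = ⊥-elim (ℕ.<⇒≱ (≡.subst (_< lineLength F₁ F₃ x) (toℕ-fromℕ< r<M) (bounded x _ dot)) length≤r)

  transfer-supported : ∀ {X} → SupportedIn G X → SupportedIn (compose F₁ (full m₁ n₃) F₃) (transfer X)
  transfer-supported X-supported = layout-supported F₁-ferrers F₃-ferrers (lineData-supported X-supported)

  transfer-linear : ∀ {k} (a : Fin k → Carrier) (X : Fin k → Mat K M N) i j →
                    ∑ K (λ t → a t * transfer (X t) i j) ≈ transfer (lincomb K a X) i j
  transfer-linear a X i j = trans (layout-linear a (lineData ∘ X) i j)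
    (layout-cong (λ x r → padded-linear a (λ t r → X t r (κ x)) r) i j)

  transfer-faithful : ∀ {X} → SupportedIn G X → IsZeroMat K (transfer X) → IsZeroMat K X
  transfer-faithful {X} X-supported transfer≈0 r l with G r l in dot
  ... | false = X-supported r l dot
  ... | true with covers r l dot
  ...   | x , ≡.refl = trans (reflexive (≡.sym (padded-toℕ (λ r → X r (κ x)) r)))
                             (layout-faithful 1≤n₁ 1≤m₃ (supported⇒fits (lineData-supported X-supported))
                                              transfer≈0 x (toℕ r))

  -- A nonsingular δ × δ minor of δ independent rows of X gives δ independent columns of X; each of
  -- them carries a dot of G, so it is the column of a line.
  transfer-rank : ∀ {X δ} → SupportedIn G X → RankAtLeast K X δ → RankAtLeast K (transfer X) δ
  transfer-rank {X} {δ} X-supported (rows , _ , rows-independent) =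
    LayoutRank.layout-rank K _≟_ 1≤n₁ 1≤m₃ (supported⇒fits (lineData-supported X-supported)) line line-independent
    where
    minor : Σ (Fin δ → Fin N) λ col → Independent (λ k t → X (rows t) (col k))
    minor = independentMinor rows-independent
    col : Fin δ → Fin N
    col = proj₁ minor
    columns-independent : Independent (λ k (r : Fin M) → X r (col k))
    columns-independent = independent-fromProjection (λ k r → X r (col k)) rows (λ _ _ → refl) (proj₂ minor)
    lineOf : ∀ k → ∃ λ x → κ x ≡ col k
    lineOf k with nonzeroEntry columns-independent k
    ... | r , X≉0 with G r (col k) in dot
    ...   | true  = covers r (col k) dot
    ...   | false = ⊥-elim (X≉0 (X-supported r (col k) dot))
    line : Fin δ → Line m₁ n₃
    line k = proj₁ (lineOf k)
    line-independent : Independent (λ k → lineData X (line k))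
    line-independent = independent-fromProjection (λ k → lineData X (line k)) toℕ
      (λ k r → reflexive (≡.sym (≡.trans (padded-toℕ (λ r → X r (κ (line k))) r) (≡.cong (X r) (proj₂ (lineOf k))))))
      columns-independent

  module Combined {k₁ k₄} (B₁ : Fin k₁ → Mat K M N) (B₁-supported : ∀ t → SupportedIn G (B₁ t))
                  (B₄ : Fin k₄ → Mat K m₁ n₃) where

    B : Fin (k₁ + k₄) → Mat K (m₁ + m₃) (n₁ + n₃)
    B = (transfer ∘ B₁) Vector.++ (topRight ∘ B₄)

    B-↑ˡ : ∀ t → B (t ↑ˡ k₄) ≡ transfer (B₁ t)
    B-↑ˡ = lookup-++ˡ (transfer ∘ B₁) (topRight ∘ B₄)

    B-↑ʳ : ∀ t → B (k₁ ↑ʳ t) ≡ topRight (B₄ t)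
    B-↑ʳ = lookup-++ʳ (transfer ∘ B₁) (topRight ∘ B₄)

    B-supported : ∀ t → SupportedIn (compose F₁ (full m₁ n₃) F₃) (B t)
    B-supported = ∀-splitAt k₁
      (λ t i j noDot → trans (reflexive (≡.cong (λ A → A i j) (B-↑ˡ t))) (transfer-supported (B₁-supported t) i j noDot))
      (λ t i j noDot → trans (reflexive (≡.cong (λ A → A i j) (B-↑ʳ t))) (topRight-supported (B₄ t) i j noDot))

    X : (Fin (k₁ + k₄) → Carrier) → Mat K M N
    X cs = lincomb K (λ t → cs (t ↑ˡ k₄)) B₁

    Y : (Fin (k₁ + k₄) → Carrier) → Mat K m₁ n₃
    Y cs = lincomb K (λ t → cs (k₁ ↑ʳ t)) B₄

    X-supported : ∀ cs → SupportedIn G (X cs)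
    X-supported cs = lincomb-supported B₁-supported (λ t → cs (t ↑ˡ k₄))

    B-split : ∀ cs i j → lincomb K cs B i j ≈ transfer (X cs) i j ⊕ topRight (Y cs) i j
    B-split cs i j = begin
      lincomb K cs B i j
        ≈⟨ ∑-splitAt k₁ (λ t → cs t * B t i j) ⟩
      ∑ K (λ t → cs (t ↑ˡ k₄) * B (t ↑ˡ k₄) i j) ⊕ ∑ K (λ t → cs (k₁ ↑ʳ t) * B (k₁ ↑ʳ t) i j)
        ≈⟨ +-cong (∑-cong {k₁} (λ t → reflexive (≡.cong (λ A → cs (t ↑ˡ k₄) * A i j) (B-↑ˡ t))))
                  (∑-cong {k₄} (λ t → reflexive (≡.cong (λ A → cs (k₁ ↑ʳ t) * A i j) (B-↑ʳ t)))) ⟩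
      ∑ K (λ t → cs (t ↑ˡ k₄) * transfer (B₁ t) i j) ⊕ ∑ K (λ t → cs (k₁ ↑ʳ t) * topRight (B₄ t) i j)
        ≈⟨ +-cong (transfer-linear (λ t → cs (t ↑ˡ k₄)) B₁ i j) (topRight-linear (λ t → cs (k₁ ↑ʳ t)) B₄ i j) ⟩
      transfer (X cs) i j ⊕ topRight (Y cs) i j ∎

    B-topRight : ∀ cs i j → lincomb K cs B (i ↑ˡ m₃) (n₁ ↑ʳ j) ≈ Y cs i j
    B-topRight cs i j = trans (B-split cs _ _)
      (trans (+-cong (reflexive (layout-topRight (lineData (X cs)) i j)) (reflexive (topRight-topRight (Y cs) i j)))
             (+-identityˡ _))

    B-independent : (∀ cs → IsZeroMat K (lincomb K cs B₁) → ∀ t → cs t ≈ 0#) →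
                    (∀ cs → IsZeroMat K (lincomb K cs B₄) → ∀ t → cs t ≈ 0#) →
                    ∀ cs → IsZeroMat K (lincomb K cs B) → ∀ t → cs t ≈ 0#
    B-independent B₁-independent B₄-independent cs B≈0 = ∀-splitAt k₁ (B₁-independent _ X≈0) (B₄-independent _ Y≈0)
      where
      Y≈0 : IsZeroMat K (Y cs)
      Y≈0 i j = trans (sym (B-topRight cs i j)) (B≈0 _ _)
      X≈0 : IsZeroMat K (X cs)
      X≈0 = transfer-faithful (X-supported cs)
              (λ i j → ⊕≈0-cancelʳ (topRight-zero Y≈0 i j) (trans (sym (B-split cs i j)) (B≈0 i j)))

    B-rank-topRight : ∀ {δ₄} cs → RankAtLeast K (Y cs) δ₄ → RankAtLeast K (lincomb K cs B) δ₄
    B-rank-topRight cs (rows , _ , rows-independent) =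
      rankAtLeast (lincomb K cs B) (λ t → rows t ↑ˡ m₃)
        (independent-fromProjection (λ t → lincomb K cs B (rows t ↑ˡ m₃)) (n₁ ↑ʳ_)
          (λ t j → sym (B-topRight cs (rows t) j)) rows-independent)

    B-rank-transfer : ∀ {δ₁} cs → IsZeroMat K (Y cs) → RankAtLeast K (X cs) δ₁ → RankAtLeast K (lincomb K cs B) δ₁
    B-rank-transfer cs Y≈0 X-rank = RankAtLeast-cong B≈transfer (transfer-rank (X-supported cs) X-rank)
      where
      B≈transfer : ∀ i j → transfer (X cs) i j ≈ lincomb K cs B i j
      B≈transfer i j = sym (trans (B-split cs i j) (trans (+-congˡ (topRight-zero Y≈0 i j)) (+-identityʳ _)))

    X≈0⇒B≈0 : ∀ cs → IsZeroMat K (Y cs) → IsZeroMat K (X cs) → IsZeroMat K (lincomb K cs B)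
    X≈0⇒B≈0 cs Y≈0 X≈0 i j = trans (B-split cs i j)
      (trans (+-cong (layout-zero (λ x r → padded-zero (λ r′ → X≈0 r′ (κ x)) r) i j) (topRight-zero Y≈0 i j))
             (+-identityʳ 0#))

  combine : ∀ {k₁ δ₁ k₄ δ₄} → Code K G k₁ δ₁ → Code K (full m₁ n₃) k₄ δ₄ →
            Code K (compose F₁ (full m₁ n₃) F₃) (k₁ + k₄) (δ₁ ⊓ δ₄)
  combine {δ₁ = δ₁} {δ₄ = δ₄} (B₁ , B₁-supported , B₁-independent , B₁-rank) (B₄ , _ , B₄-independent , B₄-rank) =
    B , B-supported , B-independent B₁-independent B₄-independent , B-rank
    where
    open Combined B₁ B₁-supported B₄
    B-rank : ∀ cs → ¬ IsZeroMat K (lincomb K cs B) → RankAtLeast K (lincomb K cs B) (δ₁ ⊓ δ₄)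
    B-rank cs B≉0 with isZeroMat? (Y cs)
    ... | no  Y≉0 = RankAtLeast-mono (lincomb K cs B) (ℕ.m⊓n≤n δ₁ δ₄) (B-rank-topRight cs (B₄-rank _ Y≉0))
    ... | yes Y≈0 = RankAtLeast-mono (lincomb K cs B) (ℕ.m⊓n≤m δ₁ δ₄)
                      (B-rank-transfer cs Y≈0 (B₁-rank _ (B≉0 ∘ X≈0⇒B≈0 cs Y≈0)))

-- Matching the columns of F₁₂₃ with the lines of F

module _ {M N} {G : Diagram M N} (G-ferrers : IsFerrers G) {L} (α ν : Fin L → ℕ) (α↭ν : tabulate α ↭ tabulate ν)
         (columns : ∀ l → Σ (toℕ l < N) λ l<N → colCount G (fromℕ< l<N) ≡ α l) (sumFin-α≡size : sumFin α ≡ size G) where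

  private
    columnOf : Fin L → Fin N
    columnOf l = fromℕ< (proj₁ (columns l))

    L≤N : L ≤ N
    L≤N = indices<⇒≤ (proj₁ ∘ columns)

    columnOf-inject≤ : ∀ l → columnOf l ≡ inject≤ l L≤N
    columnOf-inject≤ l = toℕ-injective (≡.trans (toℕ-fromℕ< _) (≡.sym (toℕ-inject≤ l L≤N)))

    -- The first L columns already hold all |G| dots.
    dotted⇒<L : ∀ {r l} → Dot G r l → toℕ l < L
    dotted⇒<L {r} {l} dot with toℕ l <? L
    ... | yes l<L = l<L
    ... | no  l≮L = ⊥-elim (ℕ.n≮0 (≡.subst (toℕ r <_) later≡0 (Ferrers.dot⇒<colCount G-ferrers dot)))
      where
      prefix≡total : sumFin (λ l → colCount G (inject≤ l L≤N)) ≡ sumFin (colCount G)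
      prefix≡total = ≡.trans (sumFin-cong λ l → ≡.trans (≡.cong (colCount G) (≡.sym (columnOf-inject≤ l))) (proj₂ (columns l)))
                             (≡.trans sumFin-α≡size (size≡sumFin-colCount G))
      later≡0 : colCount G l ≡ 0
      later≡0 = sumFin-prefix⇒later≡0 L (colCount G) L≤N prefix≡total l (ℕ.≮⇒≥ l≮L)

  columnAssignment : ColumnAssignment ν G
  columnAssignment = record { κ = κ ; bounded = bounded ; covers = covers }
    where
    σ : Permutation′ L
    σ = proj₁ (↭-tabulate⇒permutation α↭ν)
    κ : Fin L → Fin N
    κ p = columnOf (σ ⟨$⟩ˡ p)
    colCount-κ : ∀ p → colCount G (κ p) ≡ ν p
    colCount-κ p = ≡.trans (proj₂ (columns (σ ⟨$⟩ˡ p)))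
                           (≡.trans (proj₂ (↭-tabulate⇒permutation α↭ν) (σ ⟨$⟩ˡ p)) (≡.cong ν (inverseʳ σ)))
    bounded : ∀ p r → Dot G r (κ p) → toℕ r < ν p
    bounded p r dot = ≡.subst (toℕ r <_) (colCount-κ p) (Ferrers.dot⇒<colCount G-ferrers dot)
    covers : ∀ r l → Dot G r l → ∃ λ p → κ p ≡ l
    covers r l dot = σ ⟨$⟩ʳ l′ , ≡.trans (≡.cong columnOf (inverseˡ σ))
                                         (toℕ-injective (≡.trans (toℕ-fromℕ< _) (toℕ-fromℕ< (dotted⇒<L dot))))
      where
      l′ : Fin L
      l′ = fromℕ< (dotted⇒<L dot)

decode : ∀ {m₁ n₃} → Fin (suc (m₁ + n₃)) → Line m₁ n₃
decode = corner Vector.∷ (row Vector.++ column)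

encode : ∀ {m₁ n₃} → Line m₁ n₃ → Fin (suc (m₁ + n₃))
encode         corner     = fzero
encode {n₃ = n₃} (row i)  = fsuc (i ↑ˡ n₃)
encode {m₁}    (column j) = fsuc (m₁ ↑ʳ j)

decode-encode : ∀ {m₁ n₃} (x : Line m₁ n₃) → decode (encode x) ≡ x
decode-encode corner     = ≡.refl
decode-encode (row i)    = lookup-++ˡ row column i
decode-encode (column j) = lookup-++ʳ row column j

encode-decode : ∀ {m₁ n₃} (p : Fin (suc (m₁ + n₃))) → encode {m₁} {n₃} (decode p) ≡ p
encode-decode         fzero    = ≡.refl
encode-decode {m₁} (fsuc k) with splitAt m₁ k in eq
... | inj₁ i = ≡.cong fsuc (splitAt⁻¹-↑ˡ eq)
... | inj₂ j = ≡.cong fsuc (splitAt⁻¹-↑ʳ eq)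

lineLength-decode : ∀ {m₁ n₁ m₃ n₃} (F₁ : Diagram m₁ n₁) (F₃ : Diagram m₃ n₃) p →
                    lineLength F₁ F₃ (decode p) ≡ (1 Vector.∷ (rowCount F₁ Vector.++ colCount F₃)) p
lineLength-decode         F₁ F₃ fzero    = ≡.refl
lineLength-decode {m₁} F₁ F₃ (fsuc k) with splitAt m₁ k
... | inj₁ _ = ≡.refl
... | inj₂ _ = ≡.refl

ColumnAssignment-decode : ∀ {m₁ n₃ M N} {G : Diagram M N} {length : Line m₁ n₃ → ℕ} →
                          ColumnAssignment (length ∘ decode) G → ColumnAssignment length G
ColumnAssignment-decode {length = length} assignment = record
  { κ       = κ ∘ encode
  ; bounded = λ x r dot → ≡.subst (λ y → toℕ r < length y) (decode-encode x) (bounded (encode x) r dot)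
  ; covers  = λ r l dot → let (p , κp≡l) = covers r l dot in decode p , ≡.trans (≡.cong κ (encode-decode p)) κp≡l
  }
  where open ColumnAssignment assignment

decidable : ∀ {c ℓ} (K : Field c ℓ) {q} → HasCardinality K q → Decidable (Field._≈_ K)
decidable K card x y = map′ from-injective (Inverse.from-cong card) (Inverse.from card x Fin.≟ Inverse.from card y)
  where
  open Field K using (_≈_; sym; trans)
  from-injective : Inverse.from card x ≡ Inverse.from card y → x ≈ y
  from-injective eq = trans (sym (Inverse.inverseˡ card ≡.refl)) (trans (Inverse.to-cong card eq) (Inverse.inverseˡ card ≡.refl))

↭-lineLengths : ∀ {m₁ n₁ m₃ n₃} (F₁ : Diagram m₁ n₁) (F₃ : Diagram m₃ n₃) (α : Fin (suc (m₁ + n₃)) → ℕ) →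
                tabulate α ↭ (1 ∷ (tabulate (rowCount F₁) ++ tabulate (colCount F₃))) →
                tabulate α ↭ tabulate (lineLength F₁ F₃ ∘ decode)
↭-lineLengths F₁ F₃ α = ≡.subst (tabulate α ↭_)
  (≡.sym (≡.trans (tabulate-cong (lineLength-decode F₁ F₃)) (≡.cong (1 ∷_) (tabulate-++ (rowCount F₁) (colCount F₃)))))

sumFin≡size : ∀ {m₁ n₁ m₃ n₃ L M N} (F₁ : Diagram m₁ n₁) (F₃ : Diagram m₃ n₃) {G : Diagram M N} (α : Fin L → ℕ) →
              tabulate α ↭ (1 ∷ (tabulate (rowCount F₁) ++ tabulate (colCount F₃))) →
              IsProperCombination (family3 F₁ (full 1 1) F₃) G → sumFin α ≡ size G
sumFin≡size F₁ F₃ {G} α α↭ proper = begin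
  sumFin α                                                          ≡⟨ sum-tabulate α ⟨
  sum (tabulate α)                                                  ≡⟨ sum-↭ α↭ ⟩
  1 + sum (tabulate (rowCount F₁) ++ tabulate (colCount F₃))        ≡⟨ ≡.cong (1 +_) (sum-++ (tabulate (rowCount F₁)) _) ⟩
  1 + (sum (tabulate (rowCount F₁)) + sum (tabulate (colCount F₃))) ≡⟨ ≡.cong₂ (λ a b → 1 + (a + b)) sum-rows sum-columns ⟩
  1 + (size F₁ + size F₃)                                           ≡⟨ rearrange (size F₁) (size F₃) ⟩
  size F₁ + (1 + (size F₃ + 0))                                     ≡⟨ IsProperCombination.sizes proper ⟩
  size G                                                            ∎
  where
  open ≡-Reasoning
  sum-rows : sum (tabulate (rowCount F₁)) ≡ size F₁
  sum-rows = sum-tabulate (rowCount F₁)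
  sum-columns : sum (tabulate (colCount F₃)) ≡ size F₃
  sum-columns = ≡.trans (sum-tabulate (colCount F₃)) (≡.sym (size≡sumFin-colCount F₃))
  rearrange : ∀ a b → 1 + (a + b) ≡ a + (1 + (b + 0))
  rearrange = solve-∀

mainTheorem7 :
    ∀ {c ℓ : Level} (q : ℕ) → PrimePower q →
    (K : Field c ℓ) → HasCardinality K q →
    (m₁ n₁ m₃ n₃ : ℕ) → 1 ≤ m₁ → 1 ≤ n₁ → 1 ≤ m₃ → 1 ≤ n₃ →
    (F₁ : Diagram m₁ n₁) → IsFerrers F₁ →
    (F₃ : Diagram m₃ n₃) → IsFerrers F₃ →
    (α : Fin (suc (m₁ + n₃)) → ℕ) →
    (∀ (l l' : Fin (suc (m₁ + n₃))) → toℕ l ≤ toℕ l' → α l ≤ α l') →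
    tabulate α ↭ (1 ∷ (tabulate (rowCount F₁) ++ tabulate (colCount F₃))) →
    (M N : ℕ) (F₁₂₃ : Diagram M N) → IsFerrers F₁₂₃ →
    IsProperCombination (family3 F₁ (full 1 1) F₃) F₁₂₃ →
    (∀ (l : Fin (suc (m₁ + n₃))) → Σ (toℕ l < N) λ p → colCount F₁₂₃ (fromℕ< p) ≡ α l) →
    (k₁ δ₁ k₄ δ₄ : ℕ) →
    Code K F₁₂₃ k₁ δ₁ →
    Code K (full m₁ n₃) k₄ δ₄ →
    Code K (compose F₁ (full m₁ n₃) F₃) (k₁ + k₄) (δ₁ ⊓ δ₄)
mainTheorem7 q _ K card m₁ n₁ m₃ n₃ _ 1≤n₁ 1≤m₃ _ F₁ F₁-ferrers F₃ F₃-ferrers α _ α↭ M N F₁₂₃ F₁₂₃-ferrers proper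
             columns k₁ δ₁ k₄ δ₄ C₁ C₄ =
  Transfer.combine K (decidable K card) 1≤n₁ 1≤m₃ F₁-ferrers F₃-ferrers assignment C₁ C₄
  where
  assignment : ColumnAssignment (lineLength F₁ F₃) F₁₂₃
  assignment = ColumnAssignment-decode
    (columnAssignment F₁₂₃-ferrers α (lineLength F₁ F₃ ∘ decode) (↭-lineLengths F₁ F₃ α α↭) columns
                      (sumFin≡size F₁ F₃ α α↭ proper))
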